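{- \[ \mathbf{G}(x,1,q)=\left( \sum_{n=0}^\infty (-1)^n\mathbf{S}(x,q)^n\right)\cdot\sum_{k=0}^{\infty} \mathbf{P}_k(x,1,q) \mathbf{B}(x,q^k,q), \qquad\text{where}\qquad \mathbf{S}(x,q)=\sum_{k=0}^{\infty} \mathbf{P}_k(x,1,q) \mathbf{N}(x,q^k,q), \] $\mathbf{P}_k(x,u,q) := \prod_{j=0}^{k-1} \mathbf{M}(x,q^j u,q)$ with $\mathbf{P}_0=\mathbf{I}$ the $4\times 4$ identity, and \[\mathbf{M}(x,u,q)= \begin{pmatrix} 0& 0 & \frac{xuq}{qu-1} & \frac{xuq}{qu-1} \\ 0& 0 & \frac{xu^2q}{qu-1} & \frac{xu}{qu-1}\\ \frac{xuq}{qu-1} & \frac{xuq}{qu-1} & 0 & 0 \\ \frac{xu^2q^2}{qu-1} & \frac{xuq}{qu-1} & 0 & 0 \end{pmatrix}, \quad \mathbf{N}(x,u,q)= \begin{pmatrix} 0& 0 & \frac{xuq}{qu-1} & \frac{xuq}{qu-1} \\ 0& 0 & \frac{xu}{qu-1} & \frac{xu}{qu-1}\\ \frac{xuq}{qu-1} & \frac{xuq}{qu-1} & 0 & 0 \\ \frac{xuq}{qu-1} & \frac{xuq}{qu-1} & 0 & 0 \end{pmatrix}, \quad \mathbf{B}(x,u,q)= \begin{pmatrix} 0\\ 0\\ 0\\ xuq \end{pmatrix}. \]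
   Context: A Catalan word is a sequence $w_1\cdots w_n$ of nonnegative integers with $w_1=0$ and $w_i\le w_{i-1}+1$. Its Catalan polyomino $P$ has, at position $i$, a column of $w_i+1$ cells, all columns bottom-aligned. Cells are colored in a chessboard pattern with the southwestern cell black; $\mathrm{bck}(P)$ is the number of black cells, $\mathrm{len}(P)$ the number of columns, and $\mathrm{last}(P)$ the number of cells in the last column. For $a,b\in\{0,1\}$, $F_{ab}(x,u,q)=\sum_P x^{\mathrm{len}(P)}u^{\mathrm{last}(P)}q^{\mathrm{bck}(P)}$, summed over Catalan polyominoes with $\mathrm{len}(P)\equiv a$ and $\mathrm{last}(P)\equiv b \pmod 2$. Define $G_{00}(x,u,q)=F_{00}(x,\sqrt{u},q)$, $G_{01}(x,u,q)=\sqrt{u}F_{01}(x,\sqrt{u},q)$, $G_{10}(x,u,q)=F_{10}(x,\sqrt{u},q)$, $G_{11}(x,u,q)=\sqrt{u}F_{11}(x,\sqrt{u},q)$, and $\mathbf{G}(x,u,q)=(G_{00},G_{01},G_{10},G_{11})^T(x,u,q)$. These satisfy $\mathbf{G}(x,u,q)=\mathbf{M}(x,u,q)\mathbf{G}(x,qu,q)-\mathbf{N}(x,u,q)\mathbf{G}(x,1,q)+\mathbf{B}(x,u,q)$. -}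

module Defs where

open import Data.Nat as ℕ using (ℕ; zero; suc; _∸_; _≤?_; _%_)
open import Data.Nat.Base using (_≡ᵇ_)
open import Data.Integer as ℤ using (ℤ; +_; -_)
open import Data.Fin using (Fin; zero; suc)
import Data.Fin
open import Data.List using (List; []; _∷_; length; filter; upTo; map; concatMap; reverse)
open import Data.Bool using (Bool; true; false; _∧_; if_then_else_)
open import Relation.Binary.PropositionalEquality using (_≡_)
open import Relation.Nullary.Decidable using (Dec; yes; no)

allLists : ℕ → ℕ → List (List ℕ)
allLists zero    b = [] ∷ []
allLists (suc n) b = concatMap (λ v → map (v ∷_) (allLists n b)) (upTo b)

catTail : ℕ → List ℕ → Bool
catTail p []       = true
catTail p (w ∷ ws) = (w ℕ.≤ᵇ suc p) ∧ catTail w ws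

isCatalan : List ℕ → Bool
isCatalan []       = false
isCatalan (w ∷ ws) = (w ≡ᵇ 0) ∧ catTail w ws

-- Catalan words of length n (all letters of such a word are < n)
catalanWords : ℕ → List (List ℕ)
catalanWords n = filter (λ w → Data.Bool._≟_ (isCatalan w) true) (allLists n n)

-- last letter (default 0 for the empty word, which never occurs)
lastLetter : List ℕ → ℕ
lastLetter []           = 0
lastLetter (w ∷ [])     = w
lastLetter (_ ∷ v ∷ ws) = lastLetter (v ∷ ws)

-- number of black cells in the column with 0-based index c and height w+1:
-- cell (c , h) (0-based column and height) is black iff c + h is even
-- (the southwestern cell (0,0) is black)
blackInColumn : ℕ → ℕ → ℕ
blackInColumn c w = length (filter (λ h → ((h ℕ.+ c) % 2) ℕ.≟ 0) (upTo (suc w)))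

bckFrom : ℕ → List ℕ → ℕ
bckFrom c []       = 0
bckFrom c (w ∷ ws) = blackInColumn c w ℕ.+ bckFrom (suc c) ws

bck : List ℕ → ℕ
bck = bckFrom 0

-- len(P) = length w, last(P) = lastLetter w + 1

-- Formal power series in x and q over ℤ:  f n m = [x^n q^m] f

Series : Set
Series = ℕ → ℕ → ℤ

sumTo : ℕ → (ℕ → ℤ) → ℤ
sumTo zero    h = h 0
sumTo (suc n) h = sumTo n h ℤ.+ h (suc n)

0ˢ 1ˢ X Q : Series
0ˢ n m = + 0
1ˢ zero zero = + 1
1ˢ _    _    = + 0
X (suc zero) zero = + 1
X _ _ = + 0
Q zero (suc zero) = + 1
Q _ _ = + 0

infixl 6 _+ˢ_
infixl 7 _*ˢ_
_+ˢ_ : Series → Series → Series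
(f +ˢ g) n m = f n m ℤ.+ g n m

-ˢ_ : Series → Series
(-ˢ f) n m = - f n m

_*ˢ_ : Series → Series → Series
(f *ˢ g) n m = sumTo n (λ i → sumTo m (λ j → f i j ℤ.* g (n ∸ i) (m ∸ j)))

_^ˢ_ : Series → ℕ → Series
f ^ˢ zero  = 1ˢ
f ^ˢ suc k = (f ^ˢ k) *ˢ f

-- Sum of a family t₀, t₁, … of series in which t_k has total degree ≥ k
-- (i.e. [x^n q^m] t_k = 0 whenever n + m < k); such a sum converges in the
-- (x,q)-adic topology and its coefficient [x^n q^m] is the finite sum over k ≤ n+m.
Σ∞ : (ℕ → Series) → Series
Σ∞ t n m = sumTo (n ℕ.+ m) (λ k → t k n m)

-- 1/(1 - f) for f with zero constant term
inv1- : Series → Series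
inv1- f = Σ∞ (λ i → f ^ˢ i)

-- the rational function  num / (q u - 1)  = - num · 1/(1 - q u)
over[qu-1] : Series → Series → Series
over[qu-1] u num = -ˢ (num *ˢ inv1- (Q *ˢ u))

-- 4×4 matrices and vectors over Series (index order 00, 01, 10, 11)

Mat : Set
Mat = Fin 4 → Fin 4 → Series

Vec4 : Set
Vec4 = Fin 4 → Series

sum4 : (Fin 4 → Series) → Series
sum4 h = h zero +ˢ h (suc zero) +ˢ h (suc (suc zero)) +ˢ h (suc (suc (suc zero)))

infixl 7 _·_
infixr 6 _⊙_
infixr 8 _^ᴹ_
infixr 8 _^ˢ_
_·_ : Mat → Mat → Mat
(A · B) i j = sum4 (λ k → A i k *ˢ B k j)

_⊙_ : Mat → Vec4 → Vec4
(A ⊙ v) i = sum4 (λ k → A i k *ˢ v k)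

I₄ : Mat
I₄ i j with Data.Fin._≟_ i j
... | yes _ = 1ˢ
... | no _  = 0ˢ

negM : Mat → Mat
negM A i j = -ˢ A i j

_^ᴹ_ : Mat → ℕ → Mat
A ^ᴹ zero  = I₄
A ^ᴹ suc k = (A ^ᴹ k) · A

Σ∞ᴹ : (ℕ → Mat) → Mat
Σ∞ᴹ t i j = Σ∞ (λ k → t k i j)

Σ∞ⱽ : (ℕ → Vec4) → Vec4
Σ∞ⱽ t i = Σ∞ (λ k → t k i)

0' 1' 2' 3' : Fin 4
0' = zero
1' = suc zero
2' = suc (suc zero)
3' = suc (suc (suc zero))

𝐌 : Series → Mat
𝐌 u i j with i | j
... | zero | suc (suc zero) = over[qu-1] u (X *ˢ u *ˢ Q)
... | zero | suc (suc (suc zero)) = over[qu-1] u (X *ˢ u *ˢ Q)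
... | suc zero | suc (suc zero) = over[qu-1] u (X *ˢ (u ^ˢ 2) *ˢ Q)
... | suc zero | suc (suc (suc zero)) = over[qu-1] u (X *ˢ u)
... | suc (suc zero) | zero = over[qu-1] u (X *ˢ u *ˢ Q)
... | suc (suc zero) | suc zero = over[qu-1] u (X *ˢ u *ˢ Q)
... | suc (suc (suc zero)) | zero = over[qu-1] u (X *ˢ (u ^ˢ 2) *ˢ (Q ^ˢ 2))
... | suc (suc (suc zero)) | suc zero = over[qu-1] u (X *ˢ u *ˢ Q)
... | _ | _ = 0ˢ

𝐍 : Series → Mat
𝐍 u i j with i | j
... | zero | suc (suc zero) = over[qu-1] u (X *ˢ u *ˢ Q)
... | zero | suc (suc (suc zero)) = over[qu-1] u (X *ˢ u *ˢ Q)
... | suc zero | suc (suc zero) = over[qu-1] u (X *ˢ u)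
... | suc zero | suc (suc (suc zero)) = over[qu-1] u (X *ˢ u)
... | suc (suc zero) | zero = over[qu-1] u (X *ˢ u *ˢ Q)
... | suc (suc zero) | suc zero = over[qu-1] u (X *ˢ u *ˢ Q)
... | suc (suc (suc zero)) | zero = over[qu-1] u (X *ˢ u *ˢ Q)
... | suc (suc (suc zero)) | suc zero = over[qu-1] u (X *ˢ u *ˢ Q)
... | _ | _ = 0ˢ

𝐁 : Series → Vec4
𝐁 u (suc (suc (suc zero))) = X *ˢ u *ˢ Q
𝐁 u _ = 0ˢ

𝐏 : ℕ → Mat
𝐏 zero    = I₄
𝐏 (suc k) = 𝐏 k · 𝐌 (Q ^ˢ k)

𝐒 : Mat
𝐒 = Σ∞ᴹ (λ k → 𝐏 k · 𝐍 (Q ^ˢ k))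

-- G(x,1,q) = (G00, G01, G10, G11)(x,1,q), where G_ab(x,1,q) = F_ab(x,1,q)
-- (since √1 = 1).  Index i ∈ Fin 4 encodes (a,b) = (i div 2, i mod 2).

parA parB : Fin 4 → ℕ
parA zero = 0
parA (suc zero) = 0
parA _ = 1
parB zero = 0
parB (suc zero) = 1
parB (suc (suc zero)) = 0
parB (suc (suc (suc zero))) = 1

-- [x^n q^m] F_ab(x,1,q): number of Catalan polyominoes P with len(P) = n,
-- len(P) ≡ a, last(P) ≡ b (mod 2) and bck(P) = m
countF : Fin 4 → ℕ → ℕ → ℕ
countF i n m =
  length (filter (λ w → ((n % 2) ℕ.≟ parA i) Relation.Nullary.Decidable.×-dec
                        (((suc (lastLetter w)) % 2) ℕ.≟ parB i) Relation.Nullary.Decidable.×-dec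
                        (bck w ℕ.≟ m))
                 (catalanWords n))

𝐆₁ : Vec4
𝐆₁ i n m = + countF i n m

module Submission where

-- Let g k be the vector of counting series in which a Catalan polyomino P contributes
-- x^len(P) q^(bck(P) + k ⌈last(P)/2⌉), so that g k = G(x, q^k, q). Appending to P a new
-- column of height v + 1 ≤ last(P) + 1, the contributions for v and v + 2 differ exactly by
-- the factor q^(k+1) (one more black cell, one more unit of ⌈last/2⌉). Hence in
-- (1 - q^(k+1)) g k the extensions of P telescope to the two lowest and the two highest
-- columns; these give the numerators of N(x,q^k,q) g 0 and of M(x,q^k,q) g (k+1), and
-- dividing by 1 - q^(k+1) yields g k = M(q^k) g (k+1) - N(q^k) g 0 + B(q^k), B accounting
-- for the one-cell polyomino. Unrolling this n + 1 times, and using that P_(n+1) is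
-- divisible by x^(n+1), gives g 0 = V - S g 0 at x-degree n, where V = Σ P_k B(q^k).
-- As S is divisible by x, the Neumann series Σ (-S)^k inverts I + S.

open import Defs
open import Algebra.Bundles using (CommutativeRing)
open import Algebra.Core using (Op₂)
open import Algebra.Structures using (IsCommutativeRing)
import Algebra.Construct.Pointwise as Pointwise
import Algebra.Properties.CommutativeSemigroup as CommutativeSemigroupProperties
import Algebra.Properties.Ring as RingProperties
open import Data.Bool using (Bool; true; false; _∧_; T)
import Data.Bool.Properties as Bool
open import Data.Empty using (⊥-elim)
open import Data.Fin using (Fin; zero; suc)
open import Data.Fin.Patterns using (0F; 1F; 2F; 3F)
open import Data.Integer as ℤ using (ℤ; +_)
import Data.Integer.Properties as ℤ
import Data.Integer.Tactic.RingSolver as ℤ-Solver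
open import Data.List using (List; []; _∷_; _∷ʳ_; _++_; [_]; length; filter; upTo; map; concatMap)
import Data.List.Properties as List
open import Data.List.Relation.Unary.All using (All; []; _∷_)
import Data.List.Relation.Unary.All as All
open import Data.List.Relation.Unary.All.Properties using (all-upTo; All¬⇒¬Any)
open import Data.List.Relation.Unary.Any using (Any; here; there)
open import Data.Nat as ℕ using (ℕ; zero; suc; _∸_; _≤_; _<_; z≤n; s≤s; _%_; ⌊_/2⌋)
import Data.Nat.Properties as ℕ
import Data.Nat.Tactic.RingSolver as ℕ-Solver
open import Data.Product using (_,_)
open import Data.Sum using (inj₁; inj₂)
open import Function.Bundles using (Equivalence)
open import Relation.Binary.PropositionalEquality as ≡ using (_≡_; _≢_; refl; sym; trans; cong; cong₂; subst)
import Relation.Binary.Reasoning.Setoid as SetoidReasoning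
open import Relation.Nullary using (Dec; yes; no)
open import Relation.Nullary.Decidable using (_×-dec_)

open CommutativeSemigroupProperties ℤ.+-commutativeSemigroup using ()
  renaming (interchange to ℤ+-interchange)

sumTo-cong : ∀ n {h k : ℕ → ℤ} → (∀ i → h i ≡ k i) → sumTo n h ≡ sumTo n k
sumTo-cong zero    e = e 0
sumTo-cong (suc n) e = cong₂ ℤ._+_ (sumTo-cong n e) (e (suc n))

sumTo-cong-≤ : ∀ n {h k : ℕ → ℤ} → (∀ i → i ≤ n → h i ≡ k i) → sumTo n h ≡ sumTo n k
sumTo-cong-≤ zero    e = e 0 z≤n
sumTo-cong-≤ (suc n) e =
  cong₂ ℤ._+_ (sumTo-cong-≤ n (λ i i≤n → e i (ℕ.m≤n⇒m≤1+n i≤n))) (e (suc n) ℕ.≤-refl)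

sumTo-zero : ∀ n {h : ℕ → ℤ} → (∀ i → i ≤ n → h i ≡ + 0) → sumTo n h ≡ + 0
sumTo-zero zero    e = e 0 z≤n
sumTo-zero (suc n) e =
  cong₂ ℤ._+_ (sumTo-zero n (λ i i≤n → e i (ℕ.m≤n⇒m≤1+n i≤n))) (e (suc n) ℕ.≤-refl)

sumTo-distrib-+ : ∀ n (h k : ℕ → ℤ) → sumTo n (λ i → h i ℤ.+ k i) ≡ sumTo n h ℤ.+ sumTo n k
sumTo-distrib-+ zero    h k = refl
sumTo-distrib-+ (suc n) h k =
  trans (cong (ℤ._+ (h (suc n) ℤ.+ k (suc n))) (sumTo-distrib-+ n h k))
        (ℤ+-interchange (sumTo n h) (sumTo n k) (h (suc n)) (k (suc n)))

sumTo-distribˡ-* : ∀ n a (h : ℕ → ℤ) → sumTo n (λ i → a ℤ.* h i) ≡ a ℤ.* sumTo n h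
sumTo-distribˡ-* zero    a h = refl
sumTo-distribˡ-* (suc n) a h =
  trans (cong (ℤ._+ (a ℤ.* h (suc n))) (sumTo-distribˡ-* n a h)) (sym (ℤ.*-distribˡ-+ a _ _))

sumTo-neg : ∀ n (h : ℕ → ℤ) → sumTo n (λ i → ℤ.- h i) ≡ ℤ.- sumTo n h
sumTo-neg zero    h = refl
sumTo-neg (suc n) h =
  trans (cong (ℤ._+ ℤ.- h (suc n)) (sumTo-neg n h)) (sym (ℤ.neg-distrib-+ (sumTo n h) (h (suc n))))

sumTo-extend : ∀ {n} N (h : ℕ → ℤ) → n ≤ N → (∀ i → n < i → h i ≡ + 0) → sumTo N h ≡ sumTo n h
sumTo-extend {n} N h n≤N e with ℕ.m≤n⇒∃[o]m+o≡n n≤N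
... | d , refl = extend d
  where
  extend : ∀ d → sumTo (n ℕ.+ d) h ≡ sumTo n h
  extend zero    = cong (λ z → sumTo z h) (ℕ.+-identityʳ n)
  extend (suc d) rewrite ℕ.+-suc n d =
    trans (cong₂ ℤ._+_ (extend d) (e (suc (n ℕ.+ d)) (s≤s (ℕ.m≤m+n n d)))) (ℤ.+-identityʳ _)

sumTo-telescope : ∀ (f : ℕ → ℤ) n → sumTo n (λ k → f k ℤ.- f (suc k)) ≡ f 0 ℤ.- f (suc n)
sumTo-telescope f zero    = refl
sumTo-telescope f (suc n) =
  trans (cong (ℤ._+ (f (suc n) ℤ.- f (suc (suc n)))) (sumTo-telescope f n))
        (cancel (f 0) (f (suc n)) (f (suc (suc n))))
  where
  cancel : ∀ a b c → (a ℤ.- b) ℤ.+ (b ℤ.- c) ≡ a ℤ.- c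
  cancel = ℤ-Solver.solve-∀

sumTo-telescope₂ : ∀ (f : ℕ → ℤ) h →
  sumTo (suc h) (λ v → f v ℤ.- f (suc (suc v))) ≡
  (f 0 ℤ.+ f 1) ℤ.- (f (suc (suc h)) ℤ.+ f (suc (suc (suc h))))
sumTo-telescope₂ f zero    = regroup (f 0) (f 1) (f 2) (f 3)
  where
  regroup : ∀ a b c d → (a ℤ.- c) ℤ.+ (b ℤ.- d) ≡ (a ℤ.+ b) ℤ.- (c ℤ.+ d)
  regroup = ℤ-Solver.solve-∀
sumTo-telescope₂ f (suc h) =
  trans (cong (ℤ._+ (f (suc (suc h)) ℤ.- f (suc (suc (suc (suc h)))))) (sumTo-telescope₂ f h))
        (cancel (f 0 ℤ.+ f 1) (f (suc (suc h))) (f (suc (suc (suc h)))) (f (suc (suc (suc (suc h))))))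
  where
  cancel : ∀ a b c d → (a ℤ.- (b ℤ.+ c)) ℤ.+ (b ℤ.- d) ≡ a ℤ.- (c ℤ.+ d)
  cancel = ℤ-Solver.solve-∀

∑₄ : (Fin 4 → ℤ) → ℤ
∑₄ f = f 0' ℤ.+ f 1' ℤ.+ f 2' ℤ.+ f 3'

∑₄-cong : ∀ {f f′ : Fin 4 → ℤ} → (∀ j → f j ≡ f′ j) → ∑₄ f ≡ ∑₄ f′
∑₄-cong e = cong₂ ℤ._+_ (cong₂ ℤ._+_ (cong₂ ℤ._+_ (e 0') (e 1')) (e 2')) (e 3')

𝟙 : ∀ {a} {A : Set a} → Dec A → ℤ
𝟙 (yes _) = + 1
𝟙 (no _)  = + 0

𝟙ℕ : ∀ {a} {A : Set a} → Dec A → ℕ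
𝟙ℕ (yes _) = 1
𝟙ℕ (no _)  = 0

δ : ℕ → ℕ → ℤ
δ a n = 𝟙 (n ℕ.≟ a)

δ-≡ : ∀ {a n a′ n′} → (n ≡ a → n′ ≡ a′) → (n′ ≡ a′ → n ≡ a) → δ a n ≡ δ a′ n′
δ-≡ {a} {n} {a′} {n′} to from with n ℕ.≟ a | n′ ℕ.≟ a′
... | yes _  | yes _   = refl
... | no _   | no _    = refl
... | yes eq | no neq  = ⊥-elim (neq (to eq))
... | no neq | yes eq  = ⊥-elim (neq (from eq))

δ-sym : ∀ a n → δ a n ≡ δ n a
δ-sym a n = δ-≡ sym sym

δ-≢ : ∀ {a n} → n ≢ a → δ a n ≡ + 0
δ-≢ {a} {n} n≢a with n ℕ.≟ a
... | yes n≡a = ⊥-elim (n≢a n≡a)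
... | no _    = refl

δ-< : ∀ {a n} → n < a → δ a n ≡ + 0
δ-< n<a = δ-≢ (ℕ.<⇒≢ n<a)

δ-∸ : ∀ {a n} c → a ≤ n → δ c (n ∸ a) ≡ δ (a ℕ.+ c) n
δ-∸ {a} {n} c a≤n =
  δ-≡ (λ eq → trans (sym (ℕ.m+[n∸m]≡n a≤n)) (cong (a ℕ.+_) eq))
      (λ eq → trans (cong (_∸ a) eq) (ℕ.m+n∸m≡n a c))

δ-∸-+ : ∀ {s m} E → s ≤ m → δ (m ∸ s) E ≡ δ m (E ℕ.+ s)
δ-∸-+ {s} {m} E s≤m = δ-≡ (λ eq → trans (cong (ℕ._+ s) eq) (ℕ.m∸n+n≡m s≤m))
                          (λ eq → trans (sym (ℕ.m+n∸n≡m E s)) (cong (_∸ s) eq))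

sumTo-δ-> : ∀ {a} n (h : ℕ → ℤ) → n < a → sumTo n (λ i → δ a i ℤ.* h i) ≡ + 0
sumTo-δ-> n h n<a = sumTo-zero n (λ i i≤n → cong (ℤ._* h i) (δ-< (ℕ.≤-<-trans i≤n n<a)))

sumTo-δ : ∀ {a} n (h : ℕ → ℤ) → a ≤ n → sumTo n (λ i → δ a i ℤ.* h i) ≡ h a
sumTo-δ {a} zero h a≤0 with 0 ℕ.≟ a
... | yes refl = ℤ.*-identityˡ _
... | no 0≢a  = ⊥-elim (0≢a (sym (ℕ.n≤0⇒n≡0 a≤0)))
sumTo-δ {a} (suc n) h a≤1+n with suc n ℕ.≟ a
... | yes refl = trans (cong₂ ℤ._+_ (sumTo-δ-> n h ℕ.≤-refl) (ℤ.*-identityˡ _)) (ℤ.+-identityˡ _)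
... | no 1+n≢a =
  trans (ℤ.+-identityʳ _) (sumTo-δ n h (ℕ.≤-pred (ℕ.≤∧≢⇒< a≤1+n (λ eq → 1+n≢a (sym eq)))))

-- The ring of power series

module PowerSeries {c ℓ} (R : CommutativeRing c ℓ) where

  open CommutativeRing R hiding (isCommutativeRing)
    renaming (refl to ≈-refl; sym to ≈-sym; trans to ≈-trans)
  open CommutativeSemigroupProperties +-commutativeSemigroup using (interchange)
  open SetoidReasoning setoid

  Seq : Set c
  Seq = ℕ → Carrier

  infix 4 _≋_
  _≋_ : Seq → Seq → Set ℓ
  f ≋ g = ∀ n → f n ≈ g n

  ∑≤ : ℕ → (ℕ → Carrier) → Carrier
  ∑≤ zero    h = h 0
  ∑≤ (suc n) h = ∑≤ n h + h (suc n)

  ∑≤-cong-≤ : ∀ n {h k} → (∀ i → i ≤ n → h i ≈ k i) → ∑≤ n h ≈ ∑≤ n k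
  ∑≤-cong-≤ zero    e = e 0 z≤n
  ∑≤-cong-≤ (suc n) e =
    +-cong (∑≤-cong-≤ n (λ i i≤n → e i (ℕ.m≤n⇒m≤1+n i≤n))) (e (suc n) ℕ.≤-refl)

  ∑≤-cong : ∀ n {h k} → (∀ i → h i ≈ k i) → ∑≤ n h ≈ ∑≤ n k
  ∑≤-cong n e = ∑≤-cong-≤ n (λ i _ → e i)

  ∑≤-distrib-+ : ∀ n h k → ∑≤ n (λ i → h i + k i) ≈ ∑≤ n h + ∑≤ n k
  ∑≤-distrib-+ zero    h k = ≈-refl
  ∑≤-distrib-+ (suc n) h k = ≈-trans (+-congʳ (∑≤-distrib-+ n h k)) (interchange _ _ _ _)

  ∑≤-distribˡ-* : ∀ n a h → ∑≤ n (λ i → a * h i) ≈ a * ∑≤ n h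
  ∑≤-distribˡ-* zero    a h = ≈-refl
  ∑≤-distribˡ-* (suc n) a h = ≈-trans (+-congʳ (∑≤-distribˡ-* n a h)) (≈-sym (distribˡ a _ _))

  ∑≤-zero : ∀ n → ∑≤ n (λ _ → 0#) ≈ 0#
  ∑≤-zero zero    = ≈-refl
  ∑≤-zero (suc n) = ≈-trans (+-identityʳ _) (∑≤-zero n)

  ∑≤-head : ∀ n h → ∑≤ (suc n) h ≈ h 0 + ∑≤ n (λ i → h (suc i))
  ∑≤-head zero    h = ≈-refl
  ∑≤-head (suc n) h = ≈-trans (+-congʳ (∑≤-head n h)) (+-assoc _ _ _)

  infixl 7 _⋆_
  _⋆_ : Seq → Seq → Seq
  (f ⋆ g) n = ∑≤ n (λ i → f i * g (n ∸ i))

  ⋆-cong : ∀ {f f′ g g′} → f ≋ f′ → g ≋ g′ → f ⋆ g ≋ f′ ⋆ g′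
  ⋆-cong ef eg n = ∑≤-cong n (λ i → *-cong (ef i) (eg (n ∸ i)))

  ⋆-unfoldˡ : ∀ f g n → (f ⋆ g) (suc n) ≈ f 0 * g (suc n) + ((λ i → f (suc i)) ⋆ g) n
  ⋆-unfoldˡ f g n = ∑≤-head n (λ i → f i * g (suc n ∸ i))

  ⋆-unfoldʳ : ∀ f g n → (f ⋆ g) (suc n) ≈ (f ⋆ (λ i → g (suc i))) n + f (suc n) * g 0
  ⋆-unfoldʳ f g n =
    +-cong (∑≤-cong-≤ n (λ i i≤n → *-congˡ (reflexive (cong g (ℕ.+-∸-assoc 1 i≤n)))))
           (*-congˡ (reflexive (cong g (ℕ.n∸n≡0 n))))

  ⋆-comm : ∀ f g → f ⋆ g ≋ g ⋆ f
  ⋆-comm f g zero    = *-comm (f 0) (g 0)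
  ⋆-comm f g (suc n) = begin
    (f ⋆ g) (suc n)                               ≈⟨ ⋆-unfoldˡ f g n ⟩
    f 0 * g (suc n) + ((λ i → f (suc i)) ⋆ g) n   ≈⟨ +-cong (*-comm _ _) (⋆-comm _ g n) ⟩
    g (suc n) * f 0 + (g ⋆ (λ i → f (suc i))) n   ≈⟨ +-comm _ _ ⟩
    (g ⋆ (λ i → f (suc i))) n + g (suc n) * f 0   ≈⟨ ⋆-unfoldʳ g f n ⟨
    (g ⋆ f) (suc n)                               ∎

  ⋆-distribˡ : ∀ f g h → f ⋆ (λ i → g i + h i) ≋ (λ n → (f ⋆ g) n + (f ⋆ h) n)
  ⋆-distribˡ f g h n = ≈-trans (∑≤-cong n (λ i → distribˡ (f i) _ _)) (∑≤-distrib-+ n _ _)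

  ⋆-distribʳ : ∀ f g h → (λ i → g i + h i) ⋆ f ≋ (λ n → (g ⋆ f) n + (h ⋆ f) n)
  ⋆-distribʳ f g h n = ≈-trans (∑≤-cong n (λ i → distribʳ (f (n ∸ i)) _ _)) (∑≤-distrib-+ n _ _)

  ⋆-scalarˡ : ∀ a f g → (λ i → a * f i) ⋆ g ≋ (λ n → a * (f ⋆ g) n)
  ⋆-scalarˡ a f g n = ≈-trans (∑≤-cong n (λ i → *-assoc a (f i) _)) (∑≤-distribˡ-* n a _)

  ⋆-assoc : ∀ f g h → (f ⋆ g) ⋆ h ≋ f ⋆ (g ⋆ h)
  ⋆-assoc f g h zero    = *-assoc _ _ _
  ⋆-assoc f g h (suc n) = begin
    ((f ⋆ g) ⋆ h) (suc n)
      ≈⟨ ⋆-unfoldˡ (f ⋆ g) h n ⟩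
    (f 0 * g 0) * h (suc n) + ((λ i → (f ⋆ g) (suc i)) ⋆ h) n
      ≈⟨ +-congˡ (⋆-cong {g = h} (λ i → ⋆-unfoldˡ f g i) (λ _ → ≈-refl) n) ⟩
    (f 0 * g 0) * h (suc n) + ((λ i → f 0 * g (suc i) + (f′ ⋆ g) i) ⋆ h) n
      ≈⟨ +-congˡ (⋆-distribʳ h _ _ n) ⟩
    (f 0 * g 0) * h (suc n) + (((λ i → f 0 * g (suc i)) ⋆ h) n + ((f′ ⋆ g) ⋆ h) n)
      ≈⟨ +-congˡ (+-cong (⋆-scalarˡ (f 0) _ h n) (⋆-assoc f′ g h n)) ⟩
    (f 0 * g 0) * h (suc n) + (f 0 * (g′ ⋆ h) n + (f′ ⋆ (g ⋆ h)) n)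
      ≈⟨ +-assoc _ _ _ ⟨
    ((f 0 * g 0) * h (suc n) + f 0 * (g′ ⋆ h) n) + (f′ ⋆ (g ⋆ h)) n
      ≈⟨ +-congʳ (≈-trans (+-congʳ (*-assoc _ _ _)) (≈-sym (distribˡ _ _ _))) ⟩
    f 0 * (g 0 * h (suc n) + (g′ ⋆ h) n) + (f′ ⋆ (g ⋆ h)) n
      ≈⟨ +-congʳ (*-congˡ (⋆-unfoldˡ g h n)) ⟨
    f 0 * (g ⋆ h) (suc n) + (f′ ⋆ (g ⋆ h)) n
      ≈⟨ ⋆-unfoldˡ f (g ⋆ h) n ⟨
    (f ⋆ (g ⋆ h)) (suc n) ∎
    where
    f′ g′ : Seq
    f′ i = f (suc i)
    g′ i = g (suc i)

  0ₛ 1ₛ : Seq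
  0ₛ _ = 0#
  1ₛ zero    = 1#
  1ₛ (suc _) = 0#

  ⋆-zeroˡ : ∀ g → 0ₛ ⋆ g ≋ 0ₛ
  ⋆-zeroˡ g n = ≈-trans (∑≤-cong n (λ i → zeroˡ _)) (∑≤-zero n)

  ⋆-identityˡ : ∀ g → 1ₛ ⋆ g ≋ g
  ⋆-identityˡ g zero    = *-identityˡ _
  ⋆-identityˡ g (suc n) = begin
    (1ₛ ⋆ g) (suc n)             ≈⟨ ⋆-unfoldˡ 1ₛ g n ⟩
    1# * g (suc n) + (0ₛ ⋆ g) n  ≈⟨ +-cong (*-identityˡ _) (⋆-zeroˡ g n) ⟩
    g (suc n) + 0#              ≈⟨ +-identityʳ _ ⟩
    g (suc n)                   ∎

  isCommutativeRing : IsCommutativeRing _≋_ (λ f g n → f n + g n) _⋆_ (λ f n → - f n) 0ₛ 1ₛ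
  isCommutativeRing = record
    { isRing = record
      { +-isAbelianGroup = Pointwise.isAbelianGroup ℕ +-isAbelianGroup
      ; *-cong           = ⋆-cong
      ; *-assoc          = ⋆-assoc
      ; *-identity       = ⋆-identityˡ , λ f n → ≈-trans (⋆-comm f 1ₛ n) (⋆-identityˡ f n)
      ; distrib          = ⋆-distribˡ , ⋆-distribʳ
      }
    ; *-comm = ⋆-comm
    }

  commutativeRing : CommutativeRing c ℓ
  commutativeRing = record { isCommutativeRing = isCommutativeRing }

module _ {c ℓ} (R : CommutativeRing c ℓ) where

  open CommutativeRing R renaming (sym to ≈-sym; trans to ≈-trans)

  isCommutativeRing-transport : ∀ {_*′_ : Op₂ Carrier} {1′ : Carrier} →
    (∀ x y → (x *′ y) ≈ (x * y)) → 1′ ≈ 1# → IsCommutativeRing _≈_ _+_ _*′_ -_ 0# 1′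
  isCommutativeRing-transport {_*′_} {1′} *′≈* 1′≈1 = record
    { isRing = record
      { +-isAbelianGroup = +-isAbelianGroup
      ; *-cong     = λ {x} {y} {u} {v} x≈y u≈v →
                       ≈-trans (*′≈* x u) (≈-trans (*-cong x≈y u≈v) (≈-sym (*′≈* y v)))
      ; *-assoc    = λ x y z → ≈-trans (*′≈* _ z) (≈-trans (*-congʳ (*′≈* x y))
                       (≈-trans (*-assoc x y z) (≈-sym (≈-trans (*′≈* x _) (*-congˡ (*′≈* y z))))))
      ; *-identity = (λ x → ≈-trans (*′≈* 1′ x) (≈-trans (*-congʳ 1′≈1) (*-identityˡ x)))
                   , (λ x → ≈-trans (*′≈* x 1′) (≈-trans (*-congˡ 1′≈1) (*-identityʳ x)))
      ; distrib    = (λ x y z → ≈-trans (*′≈* x _) (≈-trans (distribˡ x y z)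
                       (≈-sym (+-cong (*′≈* x y) (*′≈* x z)))))
                   , (λ x y z → ≈-trans (*′≈* _ x) (≈-trans (distribʳ x y z)
                       (≈-sym (+-cong (*′≈* y x) (*′≈* z x)))))
      }
    ; *-comm = λ x y → ≈-trans (*′≈* x y) (≈-trans (*-comm x y) (≈-sym (*′≈* y x)))
    }

module ℤ[[q]] = PowerSeries ℤ.+-*-commutativeRing
module ℤ[[q]][[x]] = PowerSeries ℤ[[q]].commutativeRing

infix 4 _≈ˢ_
_≈ˢ_ : Series → Series → Set
f ≈ˢ g = ∀ n m → f n m ≡ g n m

*ˢ≈⋆ : ∀ f g → f *ˢ g ≈ˢ f ℤ[[q]][[x]].⋆ g
*ˢ≈⋆ f g n m = sym (trans (outer n (λ i → (f i ℤ[[q]].⋆ g (n ∸ i))) m)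
                          (sumTo-cong n (λ i → inner m _)))
  where
  inner : ∀ n h → ℤ[[q]].∑≤ n h ≡ sumTo n h
  inner zero    h = refl
  inner (suc n) h = cong (ℤ._+ h (suc n)) (inner n h)
  outer : ∀ n h m → ℤ[[q]][[x]].∑≤ n h m ≡ sumTo n (λ i → h i m)
  outer zero    h m = refl
  outer (suc n) h m = cong (ℤ._+ h (suc n) m) (outer n h m)

1ˢ≈1ₛ : 1ˢ ≈ˢ ℤ[[q]][[x]].1ₛ
1ˢ≈1ₛ zero    zero    = refl
1ˢ≈1ₛ zero    (suc m) = refl
1ˢ≈1ₛ (suc n) m       = refl

-- Series is ℤ[[q]][[x]], and _*ˢ_ agrees coefficientwise with its iterated Cauchy product.
seriesRing : CommutativeRing _ _
seriesRing = record
  { isCommutativeRing = isCommutativeRing-transport ℤ[[q]][[x]].commutativeRing *ˢ≈⋆ 1ˢ≈1ₛ }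

open CommutativeRing seriesRing
  using ( +-cong; +-congˡ; +-congʳ; +-assoc; +-comm; +-identityˡ; +-identityʳ
        ; -‿cong; -‿inverseˡ; *-cong; *-congˡ; *-congʳ; *-assoc; *-comm
        ; *-identityˡ; *-identityʳ; distribˡ; distribʳ; zeroˡ; zeroʳ; setoid )
  renaming (refl to ≈ˢ-refl; sym to ≈ˢ-sym; trans to ≈ˢ-trans)

open RingProperties (CommutativeRing.ring seriesRing)
  using (-‿distribˡ-*; -‿distribʳ-*; -‿involutive; -‿+-comm; -0#≈0#)

module ≈ˢ-Reasoning = SetoidReasoning setoid

monomial : ℕ → ℕ → Series
monomial a b n m = δ a n ℤ.* δ b m

monomial-*-coeff-∑ : ∀ a b f n m →
  (monomial a b *ˢ f) n m ≡ sumTo n (λ i → δ a i ℤ.* sumTo m (λ j → δ b j ℤ.* f (n ∸ i) (m ∸ j)))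
monomial-*-coeff-∑ a b f n m = sumTo-cong n λ i →
  trans (sumTo-cong m (λ j → ℤ.*-assoc (δ a i) (δ b j) _)) (sumTo-distribˡ-* m (δ a i) _)

monomial-*-coeff : ∀ {a b n m} f → a ≤ n → b ≤ m → (monomial a b *ˢ f) n m ≡ f (n ∸ a) (m ∸ b)
monomial-*-coeff {a} {b} {n} {m} f a≤n b≤m =
  trans (monomial-*-coeff-∑ a b f n m) (trans (sumTo-δ n _ a≤n) (sumTo-δ m _ b≤m))

monomial-*-coeff-<x : ∀ {a b n} f m → n < a → (monomial a b *ˢ f) n m ≡ + 0
monomial-*-coeff-<x {a} {b} {n} f m n<a = trans (monomial-*-coeff-∑ a b f n m) (sumTo-δ-> n _ n<a)

monomial-*-coeff-<q : ∀ {a b m} f n → m < b → (monomial a b *ˢ f) n m ≡ + 0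
monomial-*-coeff-<q {a} {b} {m} f n m<b = trans (monomial-*-coeff-∑ a b f n m)
  (sumTo-zero n (λ i _ → trans (cong (δ a i ℤ.*_) (sumTo-δ-> m _ m<b)) (ℤ.*-zeroʳ (δ a i))))

monomial-*-monomial : ∀ a b c d → monomial a b *ˢ monomial c d ≈ˢ monomial (a ℕ.+ c) (b ℕ.+ d)
monomial-*-monomial a b c d n m with a ℕ.≤? n | b ℕ.≤? m
... | yes a≤n | yes b≤m = trans (monomial-*-coeff (monomial c d) a≤n b≤m)
                                (cong₂ ℤ._*_ (δ-∸ c a≤n) (δ-∸ d b≤m))
... | no a≰n | _ = trans (monomial-*-coeff-<x (monomial c d) m (ℕ.≰⇒> a≰n))
  (sym (cong (ℤ._* δ (b ℕ.+ d) m) (δ-< (ℕ.<-≤-trans (ℕ.≰⇒> a≰n) (ℕ.m≤m+n a c)))))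
... | yes _ | no b≰m = trans (monomial-*-coeff-<q (monomial c d) n (ℕ.≰⇒> b≰m))
  (sym (trans (cong (δ (a ℕ.+ c) n ℤ.*_) (δ-< (ℕ.<-≤-trans (ℕ.≰⇒> b≰m) (ℕ.m≤m+n b d))))
              (ℤ.*-zeroʳ (δ (a ℕ.+ c) n))))

*ˢ-monomials : ∀ {f g a b c d a′ b′} → f ≈ˢ monomial a b → g ≈ˢ monomial c d →
  a ℕ.+ c ≡ a′ → b ℕ.+ d ≡ b′ → f *ˢ g ≈ˢ monomial a′ b′
*ˢ-monomials {a = a} {b} {c} {d} f≈ g≈ refl refl = ≈ˢ-trans (*-cong f≈ g≈) (monomial-*-monomial a b c d)

1ˢ≈monomial : 1ˢ ≈ˢ monomial 0 0
1ˢ≈monomial zero    zero    = refl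
1ˢ≈monomial zero    (suc m) = refl
1ˢ≈monomial (suc n) zero    = refl
1ˢ≈monomial (suc n) (suc m) = refl

X≈monomial : X ≈ˢ monomial 1 0
X≈monomial zero          zero    = refl
X≈monomial zero          (suc m) = refl
X≈monomial (suc zero)    zero    = refl
X≈monomial (suc zero)    (suc m) = refl
X≈monomial (suc (suc n)) m       = refl

Q≈monomial : Q ≈ˢ monomial 0 1
Q≈monomial zero    zero          = refl
Q≈monomial zero    (suc zero)    = refl
Q≈monomial zero    (suc (suc m)) = refl
Q≈monomial (suc n) zero          = refl
Q≈monomial (suc n) (suc m)       = refl

Q^≈monomial : ∀ k → Q ^ˢ k ≈ˢ monomial 0 k
Q^≈monomial zero    = 1ˢ≈monomial
Q^≈monomial (suc k) = *ˢ-monomials (Q^≈monomial k) Q≈monomial refl (ℕ.+-comm k 1)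

infixr 8 _∙ˢ_
_∙ˢ_ : ℤ → Series → Series
(c ∙ˢ f) n m = c ℤ.* f n m

∙ˢ-*ˢ : ∀ c f h n m → ((c ∙ˢ f) *ˢ h) n m ≡ c ℤ.* (f *ˢ h) n m
∙ˢ-*ˢ c f h n m = trans
  (sumTo-cong n (λ i → trans (sumTo-cong m (λ j → ℤ.*-assoc c (f i j) _)) (sumTo-distribˡ-* m c _)))
  (sumTo-distribˡ-* n c _)

*ˢ-coeff-local : ∀ {n m} {f f′ g g′ : Series} →
  (∀ i j → i ≤ n → j ≤ m → f i j ≡ f′ i j) → (∀ i j → i ≤ n → j ≤ m → g i j ≡ g′ i j) →
  (f *ˢ g) n m ≡ (f′ *ˢ g′) n m
*ˢ-coeff-local {n} {m} ef eg = sumTo-cong-≤ n λ i i≤n → sumTo-cong-≤ m λ j j≤m →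
  cong₂ ℤ._*_ (ef i j i≤n j≤m) (eg (n ∸ i) (m ∸ j) (ℕ.m∸n≤m n i) (ℕ.m∸n≤m m j))

infix 4 x^_∣_
x^_∣_ : ℕ → Series → Set
x^ d ∣ f = ∀ n m → n < d → f n m ≡ + 0

x^0∣ : ∀ f → x^ 0 ∣ f
x^0∣ f n m ()

x^∣-weaken : ∀ {d d′ f} → d ≤ d′ → x^ d′ ∣ f → x^ d ∣ f
x^∣-weaken d≤d′ d′∣f n m n<d = d′∣f n m (ℕ.<-≤-trans n<d d≤d′)

x^∣-resp-≈ˢ : ∀ {d f g} → f ≈ˢ g → x^ d ∣ f → x^ d ∣ g
x^∣-resp-≈ˢ f≈g d∣f n m n<d = trans (sym (f≈g n m)) (d∣f n m n<d)

x^∣-monomial : ∀ a b → x^ a ∣ monomial a b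
x^∣-monomial a b n m n<a = cong (ℤ._* δ b m) (δ-< n<a)

x^∣-+ : ∀ {d f g} → x^ d ∣ f → x^ d ∣ g → x^ d ∣ f +ˢ g
x^∣-+ d∣f d∣g n m n<d = cong₂ ℤ._+_ (d∣f n m n<d) (d∣g n m n<d)

x^∣-neg : ∀ {d f} → x^ d ∣ f → x^ d ∣ -ˢ f
x^∣-neg d∣f n m n<d = cong ℤ.-_ (d∣f n m n<d)

x^∣-* : ∀ {a b f g} → x^ a ∣ f → x^ b ∣ g → x^ (a ℕ.+ b) ∣ f *ˢ g
x^∣-* {a} {b} {f} {g} a∣f b∣g n m n<a+b =
  sumTo-zero n (λ i i≤n → sumTo-zero m (λ j _ → term i j i≤n))
  where
  term : ∀ i j → i ≤ n → f i j ℤ.* g (n ∸ i) (m ∸ j) ≡ + 0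
  term i j i≤n with i ℕ.<? a
  ... | yes i<a = cong (ℤ._* g (n ∸ i) (m ∸ j)) (a∣f i j i<a)
  ... | no i≮a  = trans (cong (f i j ℤ.*_) (b∣g (n ∸ i) (m ∸ j) n∸i<b)) (ℤ.*-zeroʳ (f i j))
    where
    n∸i<b : n ∸ i < b
    n∸i<b = ℕ.+-cancelˡ-< i (n ∸ i) b (ℕ.≤-<-trans (ℕ.≤-reflexive (ℕ.m+[n∸m]≡n i≤n))
              (ℕ.<-≤-trans n<a+b (ℕ.+-monoˡ-≤ b (ℕ.≮⇒≥ i≮a))))

x^∣-∙ˢ : ∀ {d f} c → x^ d ∣ f → x^ d ∣ c ∙ˢ f
x^∣-∙ˢ c d∣f n m n<d = trans (cong (c ℤ.*_) (d∣f n m n<d)) (ℤ.*-zeroʳ c)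

∑ˢ : ℕ → (ℕ → Series) → Series
∑ˢ N t n m = sumTo N (λ k → t k n m)

Σ∞-truncate : ∀ {t} → (∀ k → x^ k ∣ t k) → ∀ n m {N} → n ≤ N → Σ∞ t n m ≡ ∑ˢ N t n m
Σ∞-truncate {t} k∣t n m {N} n≤N =
  trans (sumTo-extend (n ℕ.+ m) _ (ℕ.m≤m+n n m) vanish) (sym (sumTo-extend N _ n≤N vanish))
  where
  vanish : ∀ k → n < k → t k n m ≡ + 0
  vanish k n<k = k∣t k n m n<k

∑ˢ-distribʳ-* : ∀ N t f → ∑ˢ N t *ˢ f ≈ˢ ∑ˢ N (λ k → t k *ˢ f)
∑ˢ-distribʳ-* zero    t f n m = refl
∑ˢ-distribʳ-* (suc N) t f =
  ≈ˢ-trans (distribʳ f (∑ˢ N t) (t (suc N))) (+-congʳ {t (suc N) *ˢ f} (∑ˢ-distribʳ-* N t f))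

Σ∞-*-coeff : ∀ {t} → (∀ k → x^ k ∣ t k) → ∀ f n m {N} → n ≤ N →
  (Σ∞ t *ˢ f) n m ≡ ∑ˢ N (λ k → t k *ˢ f) n m
Σ∞-*-coeff {t} k∣t f n m {N} n≤N =
  trans (*ˢ-coeff-local {n} {m} {f′ = ∑ˢ N t} {g′ = f}
          (λ i j i≤n _ → Σ∞-truncate k∣t i j (ℕ.≤-trans i≤n n≤N)) (λ _ _ _ _ → refl))
        (∑ˢ-distribʳ-* N t f n m)

x^∣-Σ∞ : ∀ {d t} → (∀ k → x^ d ∣ t k) → x^ d ∣ Σ∞ t
x^∣-Σ∞ d∣t n m n<d = sumTo-zero (n ℕ.+ m) (λ k _ → d∣t k n m n<d)

^ˢ-cong : ∀ {a b} t → a ≈ˢ b → a ^ˢ t ≈ˢ b ^ˢ t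
^ˢ-cong zero    a≈b = ≈ˢ-refl
^ˢ-cong (suc t) a≈b = *-cong (^ˢ-cong t a≈b) a≈b

monomial-^ : ∀ a b t → monomial a b ^ˢ t ≈ˢ monomial (t ℕ.* a) (t ℕ.* b)
monomial-^ a b zero    = 1ˢ≈monomial
monomial-^ a b (suc t) =
  *ˢ-monomials (monomial-^ a b t) (≈ˢ-refl {monomial a b}) (ℕ.+-comm (t ℕ.* a) a) (ℕ.+-comm (t ℕ.* b) b)

geometric-sum : ∀ a N → (1ˢ +ˢ -ˢ a) *ˢ ∑ˢ N (a ^ˢ_) ≈ˢ 1ˢ +ˢ -ˢ (a ^ˢ suc N)
geometric-sum a zero = begin
  (1ˢ +ˢ -ˢ a) *ˢ ∑ˢ 0 (a ^ˢ_)  ≈⟨ *-congˡ {1ˢ +ˢ -ˢ a} {∑ˢ 0 (a ^ˢ_)} {1ˢ} (λ _ _ → refl) ⟩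
  (1ˢ +ˢ -ˢ a) *ˢ 1ˢ            ≈⟨ *-identityʳ _ ⟩
  1ˢ +ˢ -ˢ a                    ≈⟨ +-congˡ {1ˢ} (-‿cong (*-identityˡ a)) ⟨
  1ˢ +ˢ -ˢ (1ˢ *ˢ a)            ∎
  where open ≈ˢ-Reasoning
geometric-sum a (suc N) = begin
  (1ˢ +ˢ -ˢ a) *ˢ ∑ˢ (suc N) (a ^ˢ_)
    ≈⟨ *-congˡ {1ˢ +ˢ -ˢ a} {∑ˢ (suc N) (a ^ˢ_)} {s +ˢ p} (λ _ _ → refl) ⟩
  (1ˢ +ˢ -ˢ a) *ˢ (s +ˢ p)
    ≈⟨ distribˡ (1ˢ +ˢ -ˢ a) s p ⟩
  (1ˢ +ˢ -ˢ a) *ˢ s +ˢ (1ˢ +ˢ -ˢ a) *ˢ p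
    ≈⟨ +-cong (geometric-sum a N) (distribʳ p 1ˢ (-ˢ a)) ⟩
  (1ˢ +ˢ -ˢ p) +ˢ (1ˢ *ˢ p +ˢ -ˢ a *ˢ p)
    ≈⟨ +-congˡ {1ˢ +ˢ -ˢ p}
         (+-cong (*-identityˡ p) (≈ˢ-trans (≈ˢ-sym (-‿distribˡ-* a p)) (-‿cong (*-comm a p)))) ⟩
  (1ˢ +ˢ -ˢ p) +ˢ (p +ˢ -ˢ (p *ˢ a))
    ≈⟨ +-assoc 1ˢ (-ˢ p) (p +ˢ -ˢ (p *ˢ a)) ⟩
  1ˢ +ˢ (-ˢ p +ˢ (p +ˢ -ˢ (p *ˢ a)))
    ≈⟨ +-congˡ {1ˢ} (+-assoc (-ˢ p) p (-ˢ (p *ˢ a))) ⟨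
  1ˢ +ˢ ((-ˢ p +ˢ p) +ˢ -ˢ (p *ˢ a))
    ≈⟨ +-congˡ {1ˢ} (≈ˢ-trans (+-congʳ { -ˢ (p *ˢ a)} (-‿inverseˡ p)) (+-identityˡ _)) ⟩
  1ˢ +ˢ -ˢ (p *ˢ a) ∎
  where
  open ≈ˢ-Reasoning
  s p : Series
  s = ∑ˢ N (a ^ˢ_)
  p = a ^ˢ suc N

inv1-‿inverse : ∀ a → (∀ t n m → n ℕ.+ m < t → (a ^ˢ t) n m ≡ + 0) → (1ˢ +ˢ -ˢ a) *ˢ inv1- a ≈ˢ 1ˢ
inv1-‿inverse a small n m = begin
  ((1ˢ +ˢ -ˢ a) *ˢ inv1- a) n m
    ≡⟨ *ˢ-coeff-local {f′ = 1ˢ +ˢ -ˢ a} {g′ = ∑ˢ (n ℕ.+ m) (a ^ˢ_)} (λ _ _ _ _ → refl) truncate ⟩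
  ((1ˢ +ˢ -ˢ a) *ˢ ∑ˢ (n ℕ.+ m) (a ^ˢ_)) n m
    ≡⟨ geometric-sum a (n ℕ.+ m) n m ⟩
  1ˢ n m ℤ.- (a ^ˢ suc (n ℕ.+ m)) n m
    ≡⟨ cong (λ z → 1ˢ n m ℤ.- z) (small (suc (n ℕ.+ m)) n m ℕ.≤-refl) ⟩
  1ˢ n m ℤ.- + 0
    ≡⟨ ℤ.+-identityʳ _ ⟩
  1ˢ n m ∎
  where
  open ≡.≡-Reasoning
  truncate : ∀ i j → i ≤ n → j ≤ m → inv1- a i j ≡ ∑ˢ (n ℕ.+ m) (a ^ˢ_) i j
  truncate i j i≤n j≤m =
    sym (sumTo-extend (n ℕ.+ m) _ (ℕ.+-mono-≤ i≤n j≤m) (λ t i+j<t → small t i j i+j<t))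

-- 4 × 4 matrices of series and the Neumann series

infix 4 _≈ⱽ_
_≈ⱽ_ : Vec4 → Vec4 → Set
v ≈ⱽ w = ∀ i → v i ≈ˢ w i

infixl 5 _+ⱽ_
_+ⱽ_ : Vec4 → Vec4 → Vec4
(v +ⱽ w) i = v i +ˢ w i

-ⱽ_ : Vec4 → Vec4
(-ⱽ v) i = -ˢ v i

sum4-cong : ∀ {h k : Fin 4 → Series} → (∀ j → h j ≈ˢ k j) → sum4 h ≈ˢ sum4 k
sum4-cong e = +-cong (+-cong (+-cong (e 0') (e 1')) (e 2')) (e 3')

open CommutativeSemigroupProperties (CommutativeRing.+-commutativeSemigroup seriesRing) using ()
  renaming (interchange to +ˢ-interchange)

sum4-distrib-+ : ∀ (h k : Fin 4 → Series) → sum4 (λ j → h j +ˢ k j) ≈ˢ sum4 h +ˢ sum4 k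
sum4-distrib-+ h k =
  ≈ˢ-trans (+-congʳ (≈ˢ-trans (+-congʳ (+ˢ-interchange (h 0') (k 0') (h 1') (k 1')))
                             (+ˢ-interchange (h 0' +ˢ h 1') (k 0' +ˢ k 1') (h 2') (k 2'))))
           (+ˢ-interchange (h 0' +ˢ h 1' +ˢ h 2') (k 0' +ˢ k 1' +ˢ k 2') (h 3') (k 3'))

sum4-distribˡ-* : ∀ f (h : Fin 4 → Series) → f *ˢ sum4 h ≈ˢ sum4 (λ j → f *ˢ h j)
sum4-distribˡ-* f h = ≈ˢ-trans (distribˡ f (h 0' +ˢ h 1' +ˢ h 2') (h 3'))
  (+-congʳ (≈ˢ-trans (distribˡ f (h 0' +ˢ h 1') (h 2')) (+-congʳ (distribˡ f (h 0') (h 1')))))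

sum4-distribʳ-* : ∀ f (h : Fin 4 → Series) → sum4 h *ˢ f ≈ˢ sum4 (λ j → h j *ˢ f)
sum4-distribʳ-* f h = ≈ˢ-trans (distribʳ f (h 0' +ˢ h 1' +ˢ h 2') (h 3'))
  (+-congʳ (≈ˢ-trans (distribʳ f (h 0' +ˢ h 1') (h 2')) (+-congʳ (distribʳ f (h 0') (h 1')))))

sum4-neg : ∀ (h : Fin 4 → Series) → sum4 (λ j → -ˢ h j) ≈ˢ -ˢ sum4 h
sum4-neg h = ≈ˢ-trans (+-congʳ (≈ˢ-trans (+-congʳ (-‿+-comm (h 0') (h 1')))
                                         (-‿+-comm (h 0' +ˢ h 1') (h 2'))))
                      (-‿+-comm (h 0' +ˢ h 1' +ˢ h 2') (h 3'))

sum4-comm : ∀ (F : Fin 4 → Fin 4 → Series) → sum4 (λ k → sum4 (F k)) ≈ˢ sum4 (λ l → sum4 (λ k → F k l))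
sum4-comm F =
  ≈ˢ-trans (sum4-distrib-+ (λ k → F k 0' +ˢ F k 1' +ˢ F k 2') (λ k → F k 3'))
  (+-congʳ (≈ˢ-trans (sum4-distrib-+ (λ k → F k 0' +ˢ F k 1') (λ k → F k 2'))
                     (+-congʳ (sum4-distrib-+ (λ k → F k 0') (λ k → F k 1')))))

⊙-congʳ : ∀ A {v w} → v ≈ⱽ w → A ⊙ v ≈ⱽ A ⊙ w
⊙-congʳ A v≈w i = sum4-cong (λ j → *-congˡ {A i j} (v≈w j))

·-⊙ : ∀ A B v → (A · B) ⊙ v ≈ⱽ A ⊙ (B ⊙ v)
·-⊙ A B v i = begin
  sum4 (λ k → sum4 (λ l → A i l *ˢ B l k) *ˢ v k)
    ≈⟨ sum4-cong (λ k → sum4-distribʳ-* (v k) (λ l → A i l *ˢ B l k)) ⟩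
  sum4 (λ k → sum4 (λ l → (A i l *ˢ B l k) *ˢ v k))
    ≈⟨ sum4-cong (λ k → sum4-cong (λ l → *-assoc (A i l) (B l k) (v k))) ⟩
  sum4 (λ k → sum4 (λ l → A i l *ˢ (B l k *ˢ v k)))
    ≈⟨ sum4-comm (λ k l → A i l *ˢ (B l k *ˢ v k)) ⟩
  sum4 (λ l → sum4 (λ k → A i l *ˢ (B l k *ˢ v k)))
    ≈⟨ sum4-cong (λ l → sum4-distribˡ-* (A i l) (λ k → B l k *ˢ v k)) ⟨
  sum4 (λ l → A i l *ˢ sum4 (λ k → B l k *ˢ v k)) ∎
  where open ≈ˢ-Reasoning

⊙-distrib-+ⱽ : ∀ A v w → A ⊙ (v +ⱽ w) ≈ⱽ A ⊙ v +ⱽ A ⊙ w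
⊙-distrib-+ⱽ A v w i = ≈ˢ-trans (sum4-cong (λ j → distribˡ (A i j) (v j) (w j)))
                                (sum4-distrib-+ (λ j → A i j *ˢ v j) (λ j → A i j *ˢ w j))

⊙-neg : ∀ A v → A ⊙ (-ⱽ v) ≈ⱽ -ⱽ (A ⊙ v)
⊙-neg A v i = ≈ˢ-trans (sum4-cong (λ j → ≈ˢ-sym (-‿distribʳ-* (A i j) (v j))))
                       (sum4-neg (λ j → A i j *ˢ v j))

negM-⊙ : ∀ A v → negM A ⊙ v ≈ⱽ -ⱽ (A ⊙ v)
negM-⊙ A v i = ≈ˢ-trans (sum4-cong (λ j → ≈ˢ-sym (-‿distribˡ-* (A i j) (v j))))
                        (sum4-neg (λ j → A i j *ˢ v j))

I₄-⊙ : ∀ v → I₄ ⊙ v ≈ⱽ v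
I₄-⊙ v 0F = ≈ˢ-trans
  (+-cong (+-cong (+-cong (*-identityˡ (v 0')) (zeroˡ (v 1'))) (zeroˡ (v 2'))) (zeroˡ (v 3')))
  (≈ˢ-trans (+-identityʳ _) (≈ˢ-trans (+-identityʳ _) (+-identityʳ (v 0'))))
I₄-⊙ v 1F = ≈ˢ-trans
  (+-cong (+-cong (+-cong (zeroˡ (v 0')) (*-identityˡ (v 1'))) (zeroˡ (v 2'))) (zeroˡ (v 3')))
  (≈ˢ-trans (+-identityʳ _) (≈ˢ-trans (+-identityʳ _) (+-identityˡ (v 1'))))
I₄-⊙ v 2F = ≈ˢ-trans
  (+-cong (+-cong (+-cong (zeroˡ (v 0')) (zeroˡ (v 1'))) (*-identityˡ (v 2'))) (zeroˡ (v 3')))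
  (≈ˢ-trans (+-identityʳ ((0ˢ +ˢ 0ˢ) +ˢ v 2'))
            (≈ˢ-trans (+-congʳ {v 2'} (+-identityʳ 0ˢ)) (+-identityˡ (v 2'))))
I₄-⊙ v 3F = ≈ˢ-trans
  (+-cong (+-cong (+-cong (zeroˡ (v 0')) (zeroˡ (v 1'))) (zeroˡ (v 2'))) (*-identityˡ (v 3')))
  (≈ˢ-trans (+-congʳ {v 3'} (≈ˢ-trans (+-identityʳ (0ˢ +ˢ 0ˢ)) (+-identityʳ 0ˢ))) (+-identityˡ (v 3')))

*ˢ-⊙ : ∀ s A v i → s *ˢ (A ⊙ v) i ≈ˢ ((λ i j → A i j *ˢ s) ⊙ v) i
*ˢ-⊙ s A v i = ≈ˢ-trans (sum4-distribˡ-* s (λ j → A i j *ˢ v j)) (sum4-cong λ j →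
  ≈ˢ-trans (≈ˢ-sym (*-assoc s (A i j) (v j))) (*-congʳ {v j} (*-comm s (A i j))))

⊙-congˡ : ∀ {A B} v i → (∀ j → A i j ≈ˢ B i j) → (A ⊙ v) i ≈ˢ (B ⊙ v) i
⊙-congˡ v i e = sum4-cong (λ j → *-congʳ {v j} (e j))

*ˢ-⊙-negated : ∀ {s A B} v i → (∀ j → A i j ≈ˢ -ˢ (B i j *ˢ s)) → s *ˢ (B ⊙ v) i ≈ˢ -ˢ (A ⊙ v) i
*ˢ-⊙-negated {s} {A} {B} v i A≈-Bs = begin
  s *ˢ (B ⊙ v) i                           ≈⟨ *ˢ-⊙ s B v i ⟩
  (Bs ⊙ v) i                               ≈⟨ -‿involutive ((Bs ⊙ v) i) ⟨
  -ˢ (-ˢ (Bs ⊙ v) i)                       ≈⟨ -‿cong (negM-⊙ Bs v i) ⟨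
  -ˢ (negM Bs ⊙ v) i                       ≈⟨ -‿cong (⊙-congˡ {A} {negM Bs} v i A≈-Bs) ⟨
  -ˢ (A ⊙ v) i                             ∎
  where
  open ≈ˢ-Reasoning
  Bs : Mat
  Bs i j = B i j *ˢ s

infix 4 x^_∣ᴹ_ x^_∣ⱽ_
x^_∣ᴹ_ : ℕ → Mat → Set
x^ d ∣ᴹ A = ∀ i j → x^ d ∣ A i j

x^_∣ⱽ_ : ℕ → Vec4 → Set
x^ d ∣ⱽ v = ∀ i → x^ d ∣ v i

x^∣-sum4 : ∀ {d} {h : Fin 4 → Series} → (∀ j → x^ d ∣ h j) → x^ d ∣ sum4 h
x^∣-sum4 d∣h = x^∣-+ (x^∣-+ (x^∣-+ (d∣h 0') (d∣h 1')) (d∣h 2')) (d∣h 3')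

x^∣ⱽ-⊙ : ∀ {a b A v} → x^ a ∣ᴹ A → x^ b ∣ⱽ v → x^ (a ℕ.+ b) ∣ⱽ A ⊙ v
x^∣ⱽ-⊙ a∣A b∣v i = x^∣-sum4 (λ j → x^∣-* (a∣A i j) (b∣v j))

x^∣ᴹ-· : ∀ {a b A B} → x^ a ∣ᴹ A → x^ b ∣ᴹ B → x^ (a ℕ.+ b) ∣ᴹ A · B
x^∣ᴹ-· a∣A b∣B i j = x^∣-sum4 (λ k → x^∣-* (a∣A i k) (b∣B k j))

x^∣ᴹ-·-suc : ∀ {a A B} → x^ a ∣ᴹ A → x^ 1 ∣ᴹ B → x^ suc a ∣ᴹ A · B
x^∣ᴹ-·-suc {a} a∣A 1∣B i j = x^∣-weaken (ℕ.≤-reflexive (ℕ.+-comm 1 a)) (x^∣ᴹ-· a∣A 1∣B i j)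

x^∣ᴹ-^ : ∀ {A} → x^ 1 ∣ᴹ A → ∀ k → x^ k ∣ᴹ A ^ᴹ k
x^∣ᴹ-^ 1∣A zero    i j = x^0∣ _
x^∣ᴹ-^ 1∣A (suc k) = x^∣ᴹ-·-suc (x^∣ᴹ-^ 1∣A k) 1∣A

sum4-∑ˢ : ∀ N (t : ℕ → Fin 4 → Series) → sum4 (λ j → ∑ˢ N (λ k → t k j)) ≈ˢ ∑ˢ N (λ k → sum4 (t k))
sum4-∑ˢ N t n m = sym
  (trans (sumTo-distrib-+ N (λ k → f k 0' ℤ.+ f k 1' ℤ.+ f k 2') (λ k → f k 3'))
  (cong (ℤ._+ sumTo N (λ k → f k 3'))
    (trans (sumTo-distrib-+ N (λ k → f k 0' ℤ.+ f k 1') (λ k → f k 2'))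
    (cong (ℤ._+ sumTo N (λ k → f k 2')) (sumTo-distrib-+ N (λ k → f k 0') (λ k → f k 1'))))))
  where
  f : ℕ → Fin 4 → ℤ
  f k j = t k j n m

Σ∞ᴹ-⊙-coeff : ∀ {t} → (∀ k → x^ k ∣ᴹ t k) → ∀ v i n m {N} → n ≤ N →
  (Σ∞ᴹ t ⊙ v) i n m ≡ ∑ˢ N (λ k → (t k ⊙ v) i) n m
Σ∞ᴹ-⊙-coeff {t} k∣t v i n m {N} n≤N =
  trans (∑₄-cong (λ j → Σ∞-*-coeff (λ k → k∣t k i j) (v j) n m n≤N))
        (sum4-∑ˢ N (λ k j → t k i j *ˢ v j) n m)

⊙-neumann-term : ∀ {S V G} → V ≈ⱽ G +ⱽ S ⊙ G → ∀ A → A ⊙ V ≈ⱽ A ⊙ G +ⱽ -ⱽ ((A · negM S) ⊙ G)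
⊙-neumann-term {S} {V} {G} V≈G+SG A i = begin
  (A ⊙ V) i
    ≈⟨ ⊙-congʳ A V≈G+SG i ⟩
  (A ⊙ (G +ⱽ S ⊙ G)) i
    ≈⟨ ⊙-distrib-+ⱽ A G (S ⊙ G) i ⟩
  (A ⊙ G) i +ˢ (A ⊙ (S ⊙ G)) i
    ≈⟨ +-congˡ {(A ⊙ G) i} (⊙-congʳ A SG≈-[-SG] i) ⟩
  (A ⊙ G) i +ˢ (A ⊙ (-ⱽ (negM S ⊙ G))) i
    ≈⟨ +-congˡ {(A ⊙ G) i} (≈ˢ-trans (⊙-neg A (negM S ⊙ G) i) (-‿cong (≈ˢ-sym (·-⊙ A (negM S) G i)))) ⟩
  (A ⊙ G) i +ˢ -ˢ ((A · negM S) ⊙ G) i ∎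
  where
  open ≈ˢ-Reasoning
  SG≈-[-SG] : S ⊙ G ≈ⱽ -ⱽ (negM S ⊙ G)
  SG≈-[-SG] j = ≈ˢ-trans (≈ˢ-sym (-‿involutive _)) (-‿cong (≈ˢ-sym (negM-⊙ S G j)))

neumann-series : ∀ {S V G} → x^ 1 ∣ᴹ S → V ≈ⱽ G +ⱽ S ⊙ G →
  ∀ i n m → (Σ∞ᴹ (λ k → negM S ^ᴹ k) ⊙ V) i n m ≡ G i n m
neumann-series {S} {V} {G} 1∣S V≈G+SG i n m = begin
  (Σ∞ᴹ (λ k → negM S ^ᴹ k) ⊙ V) i n m
    ≡⟨ Σ∞ᴹ-⊙-coeff (x^∣ᴹ-^ 1∣-S) V i n m ℕ.≤-refl ⟩
  ∑ˢ n (λ k → (negM S ^ᴹ k ⊙ V) i) n m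
    ≡⟨ sumTo-cong n (λ k → ⊙-neumann-term {S} {V} {G} V≈G+SG (negM S ^ᴹ k) i n m) ⟩
  sumTo n (λ k → W k ℤ.- W (suc k))
    ≡⟨ sumTo-telescope W n ⟩
  W 0 ℤ.- W (suc n)
    ≡⟨ cong₂ ℤ._-_ (I₄-⊙ G i n m)
             (x^∣ⱽ-⊙ (x^∣ᴹ-^ 1∣-S (suc n)) (λ j → x^0∣ (G j)) i n m (ℕ.m≤m+n (suc n) 0)) ⟩
  G i n m ℤ.- + 0
    ≡⟨ ℤ.+-identityʳ _ ⟩
  G i n m ∎
  where
  open ≡.≡-Reasoning
  1∣-S : x^ 1 ∣ᴹ negM S
  1∣-S i j = x^∣-neg (1∣S i j)
  W : ℕ → ℤ
  W k = ((negM S ^ᴹ k) ⊙ G) i n m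

∑ₗ : ∀ {A : Set} → List A → (A → ℤ) → ℤ
∑ₗ []       f = + 0
∑ₗ (x ∷ xs) f = f x ℤ.+ ∑ₗ xs f

module _ {A : Set} where

  ∑ₗ-cong-All : ∀ {xs : List A} {f g} → All (λ x → f x ≡ g x) xs → ∑ₗ xs f ≡ ∑ₗ xs g
  ∑ₗ-cong-All []         = refl
  ∑ₗ-cong-All (e ∷ es) = cong₂ ℤ._+_ e (∑ₗ-cong-All es)

  ∑ₗ-cong : ∀ (xs : List A) {f g} → (∀ x → f x ≡ g x) → ∑ₗ xs f ≡ ∑ₗ xs g
  ∑ₗ-cong []       e = refl
  ∑ₗ-cong (x ∷ xs) e = cong₂ ℤ._+_ (e x) (∑ₗ-cong xs e)

  ∑ₗ-++ : ∀ (xs ys : List A) f → ∑ₗ (xs ++ ys) f ≡ ∑ₗ xs f ℤ.+ ∑ₗ ys f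
  ∑ₗ-++ []       ys f = sym (ℤ.+-identityˡ _)
  ∑ₗ-++ (x ∷ xs) ys f =
    trans (cong (λ s → f x ℤ.+ s) (∑ₗ-++ xs ys f)) (sym (ℤ.+-assoc (f x) (∑ₗ xs f) (∑ₗ ys f)))

  ∑ₗ-distrib-+ : ∀ (xs : List A) f g → ∑ₗ xs (λ x → f x ℤ.+ g x) ≡ ∑ₗ xs f ℤ.+ ∑ₗ xs g
  ∑ₗ-distrib-+ []       f g = refl
  ∑ₗ-distrib-+ (x ∷ xs) f g =
    trans (cong (λ s → f x ℤ.+ g x ℤ.+ s) (∑ₗ-distrib-+ xs f g))
          (ℤ+-interchange (f x) (g x) (∑ₗ xs f) (∑ₗ xs g))

  ∑ₗ-distribˡ-* : ∀ (xs : List A) a f → ∑ₗ xs (λ x → a ℤ.* f x) ≡ a ℤ.* ∑ₗ xs f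
  ∑ₗ-distribˡ-* []       a f = sym (ℤ.*-zeroʳ a)
  ∑ₗ-distribˡ-* (x ∷ xs) a f =
    trans (cong (λ s → a ℤ.* f x ℤ.+ s) (∑ₗ-distribˡ-* xs a f)) (sym (ℤ.*-distribˡ-+ a (f x) (∑ₗ xs f)))

  ∑ₗ-neg : ∀ (xs : List A) f → ∑ₗ xs (λ x → ℤ.- f x) ≡ ℤ.- ∑ₗ xs f
  ∑ₗ-neg []       f = refl
  ∑ₗ-neg (x ∷ xs) f =
    trans (cong (λ s → ℤ.- f x ℤ.+ s) (∑ₗ-neg xs f)) (sym (ℤ.neg-distrib-+ (f x) (∑ₗ xs f)))

  ∑ₗ-zero : ∀ (xs : List A) → ∑ₗ xs (λ _ → + 0) ≡ + 0
  ∑ₗ-zero []       = refl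
  ∑ₗ-zero (x ∷ xs) = trans (ℤ.+-identityˡ _) (∑ₗ-zero xs)

  ∑ₗ-filter : ∀ {P : A → Set} (P? : ∀ x → Dec (P x)) xs f →
    ∑ₗ (filter P? xs) f ≡ ∑ₗ xs (λ x → 𝟙 (P? x) ℤ.* f x)
  ∑ₗ-filter P? []       f = refl
  ∑ₗ-filter P? (x ∷ xs) f with P? x
  ... | yes _ = cong₂ ℤ._+_ (sym (ℤ.*-identityˡ (f x))) (∑ₗ-filter P? xs f)
  ... | no _  = trans (∑ₗ-filter P? xs f) (sym (ℤ.+-identityˡ _))

  length-filter≡∑ₗ : ∀ {P : A → Set} (P? : ∀ x → Dec (P x)) xs →
    + length (filter P? xs) ≡ ∑ₗ xs (λ x → 𝟙 (P? x))
  length-filter≡∑ₗ P? []       = refl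
  length-filter≡∑ₗ P? (x ∷ xs) with P? x
  ... | yes _ = cong (λ s → + 1 ℤ.+ s) (length-filter≡∑ₗ P? xs)
  ... | no _  = trans (length-filter≡∑ₗ P? xs) (sym (ℤ.+-identityˡ _))

∑ₗ-concatMap : ∀ {A B : Set} (g : A → List B) xs f →
  ∑ₗ (concatMap g xs) f ≡ ∑ₗ xs (λ x → ∑ₗ (g x) f)
∑ₗ-concatMap g []       f = refl
∑ₗ-concatMap g (x ∷ xs) f =
  trans (∑ₗ-++ (g x) (concatMap g xs) f) (cong (λ s → ∑ₗ (g x) f ℤ.+ s) (∑ₗ-concatMap g xs f))

∑ₗ-map : ∀ {A B : Set} (g : A → B) xs f → ∑ₗ (map g xs) f ≡ ∑ₗ xs (λ x → f (g x))
∑ₗ-map g []       f = refl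
∑ₗ-map g (x ∷ xs) f = cong (λ s → f (g x) ℤ.+ s) (∑ₗ-map g xs f)

∑ₗ-upTo-cong : ∀ b {f g} → (∀ v → v < b → f v ≡ g v) → ∑ₗ (upTo b) f ≡ ∑ₗ (upTo b) g
∑ₗ-upTo-cong b e = ∑ₗ-cong-All (All.map (e _) (all-upTo b))

∑ₗ-upTo-suc : ∀ b f → ∑ₗ (upTo (suc b)) f ≡ ∑ₗ (upTo b) f ℤ.+ f b
∑ₗ-upTo-suc b f = begin
  ∑ₗ (upTo (suc b)) f            ≡⟨ cong (λ l → ∑ₗ l f) (List.upTo-∷ʳ b) ⟨
  ∑ₗ (upTo b ++ [ b ]) f         ≡⟨ ∑ₗ-++ (upTo b) [ b ] f ⟩
  ∑ₗ (upTo b) f ℤ.+ (f b ℤ.+ + 0) ≡⟨ cong (λ s → ∑ₗ (upTo b) f ℤ.+ s) (ℤ.+-identityʳ (f b)) ⟩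
  ∑ₗ (upTo b) f ℤ.+ f b           ∎
  where open ≡.≡-Reasoning

∑ₗ-upTo : ∀ b f → ∑ₗ (upTo (suc b)) f ≡ sumTo b f
∑ₗ-upTo zero    f = ℤ.+-identityʳ (f 0)
∑ₗ-upTo (suc b) f = trans (∑ₗ-upTo-suc (suc b) f) (cong (ℤ._+ f (suc b)) (∑ₗ-upTo b f))

∑ₗ-upTo-extend : ∀ {b} b′ f → b ≤ b′ → (∀ v → b ≤ v → v < b′ → f v ≡ + 0) →
  ∑ₗ (upTo b′) f ≡ ∑ₗ (upTo b) f
∑ₗ-upTo-extend zero     f z≤n e = refl
∑ₗ-upTo-extend {b} (suc b′) f b≤1+b′ e with ℕ.m≤n⇒m<n∨m≡n b≤1+b′
... | inj₂ refl = refl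
... | inj₁ b<1+b′ = trans (∑ₗ-upTo-suc b′ f) (trans
  (cong₂ ℤ._+_ (∑ₗ-upTo-extend b′ f b≤b′ (λ v b≤v v<b′ → e v b≤v (ℕ.m<n⇒m<1+n v<b′)))
               (e b′ b≤b′ ℕ.≤-refl))
  (ℤ.+-identityʳ _))
  where
  b≤b′ : b ≤ b′
  b≤b′ = ℕ.≤-pred b<1+b′

∑₄-∑ₗ : ∀ {A : Set} (L : List A) (f : Fin 4 → A → ℤ) →
  ∑₄ (λ j → ∑ₗ L (f j)) ≡ ∑ₗ L (λ w → ∑₄ (λ j → f j w))
∑₄-∑ₗ L f = sym (trans (∑ₗ-distrib-+ L _ _) (cong (ℤ._+ ∑ₗ L (f 3F))
                (trans (∑ₗ-distrib-+ L _ _) (cong (ℤ._+ ∑ₗ L (f 2F)) (∑ₗ-distrib-+ L _ _)))))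

module _ {A : Set} (L : ℕ → List A) (p : ℕ → A → ℤ) (wt : A → ℕ) where

  monomial-*-∑ₗδ : ∀ {F} → (∀ n m → F n m ≡ ∑ₗ (L n) (λ w → p n w ℤ.* δ m (wt w))) →
    ∀ r s n m → (monomial r s *ˢ F) (r ℕ.+ n) m ≡ ∑ₗ (L n) (λ w → p n w ℤ.* δ m (wt w ℕ.+ s))
  monomial-*-∑ₗδ {F} F≡ r s n m with s ℕ.≤? m
  ... | yes s≤m = begin
    (monomial r s *ˢ F) (r ℕ.+ n) m
      ≡⟨ monomial-*-coeff F (ℕ.m≤m+n r n) s≤m ⟩
    F (r ℕ.+ n ∸ r) (m ∸ s)
      ≡⟨ cong (λ z → F z (m ∸ s)) (ℕ.m+n∸m≡n r n) ⟩
    F n (m ∸ s)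
      ≡⟨ F≡ n (m ∸ s) ⟩
    ∑ₗ (L n) (λ w → p n w ℤ.* δ (m ∸ s) (wt w))
      ≡⟨ ∑ₗ-cong (L n) (λ w → cong (p n w ℤ.*_) (δ-∸-+ (wt w) s≤m)) ⟩
    ∑ₗ (L n) (λ w → p n w ℤ.* δ m (wt w ℕ.+ s)) ∎
    where open ≡.≡-Reasoning
  ... | no s≰m = trans (monomial-*-coeff-<q F (r ℕ.+ n) m<s) (sym (trans
    (∑ₗ-cong (L n) (λ w → trans (cong (p n w ℤ.*_) (δ-≢ (ℕ.>⇒≢ (ℕ.<-≤-trans m<s (ℕ.m≤n+m s (wt w))))))
                                (ℤ.*-zeroʳ (p n w))))
    (∑ₗ-zero (L n))))
    where
    m<s : m < s
    m<s = ℕ.≰⇒> s≰m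

∑-allLists-∷ : ∀ n b G →
  ∑ₗ (allLists (suc n) b) G ≡ ∑ₗ (upTo b) (λ v → ∑ₗ (allLists n b) (λ w → G (v ∷ w)))
∑-allLists-∷ n b G = trans (∑ₗ-concatMap (λ v → map (v ∷_) (allLists n b)) (upTo b) G)
                           (∑ₗ-cong (upTo b) (λ v → ∑ₗ-map (v ∷_) (allLists n b) G))

∑-allLists-∷ʳ : ∀ n b G →
  ∑ₗ (allLists (suc n) b) G ≡ ∑ₗ (allLists n b) (λ w → ∑ₗ (upTo b) (λ v → G (w ∷ʳ v)))
∑-allLists-∷ʳ zero    b G = trans (∑-allLists-∷ zero b G)
  (trans (∑ₗ-cong (upTo b) (λ v → ℤ.+-identityʳ (G [ v ]))) (sym (ℤ.+-identityʳ _)))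
∑-allLists-∷ʳ (suc n) b G = begin
  ∑ₗ (allLists (suc (suc n)) b) G
    ≡⟨ ∑-allLists-∷ (suc n) b G ⟩
  ∑ₗ (upTo b) (λ v → ∑ₗ (allLists (suc n) b) (λ w → G (v ∷ w)))
    ≡⟨ ∑ₗ-cong (upTo b) (λ v → ∑-allLists-∷ʳ n b (λ w → G (v ∷ w))) ⟩
  ∑ₗ (upTo b) (λ v → ∑ₗ (allLists n b) (λ w → ∑ₗ (upTo b) (λ x → G (v ∷ w ∷ʳ x))))
    ≡⟨ ∑-allLists-∷ n b (λ w → ∑ₗ (upTo b) (λ x → G (w ∷ʳ x))) ⟨
  ∑ₗ (allLists (suc n) b) (λ w → ∑ₗ (upTo b) (λ x → G (w ∷ʳ x))) ∎
  where open ≡.≡-Reasoning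

∑-allLists-cong : ∀ n b {G G′} → (∀ w → length w ≡ n → All (_< b) w → G w ≡ G′ w) →
  ∑ₗ (allLists n b) G ≡ ∑ₗ (allLists n b) G′
∑-allLists-cong zero    b e = cong (ℤ._+ + 0) (e [] refl [])
∑-allLists-cong (suc n) b {G} {G′} e =
  trans (∑-allLists-∷ n b G) (trans (∑ₗ-upTo-cong b (λ v v<b → ∑-allLists-cong n b
          (λ w len w<b → e (v ∷ w) (cong suc len) (v<b ∷ w<b))))
        (sym (∑-allLists-∷ n b G′)))

∑-allLists-restrict : ∀ n {b b′} H → b ≤ b′ →
  (∀ w → length w ≡ n → All (_< b′) w → Any (b ≤_) w → H w ≡ + 0) →
  ∑ₗ (allLists n b′) H ≡ ∑ₗ (allLists n b) H
∑-allLists-restrict zero    H b≤b′ e = refl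
∑-allLists-restrict (suc n) {b} {b′} H b≤b′ e = begin
  ∑ₗ (allLists (suc n) b′) H
    ≡⟨ ∑-allLists-∷ n b′ H ⟩
  ∑ₗ (upTo b′) (λ v → ∑ₗ (allLists n b′) (λ w → H (v ∷ w)))
    ≡⟨ ∑ₗ-upTo-extend b′ _ b≤b′ ∑-allLists-vanish ⟩
  ∑ₗ (upTo b) (λ v → ∑ₗ (allLists n b′) (λ w → H (v ∷ w)))
    ≡⟨ ∑ₗ-upTo-cong b (λ v v<b → ∑-allLists-restrict n (λ w → H (v ∷ w)) b≤b′
         (λ w len w<b′ any → e (v ∷ w) (cong suc len) (ℕ.<-≤-trans v<b b≤b′ ∷ w<b′) (there any))) ⟩
  ∑ₗ (upTo b) (λ v → ∑ₗ (allLists n b) (λ w → H (v ∷ w)))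
    ≡⟨ ∑-allLists-∷ n b H ⟨
  ∑ₗ (allLists (suc n) b) H ∎
  where
  open ≡.≡-Reasoning
  ∑-allLists-vanish : ∀ v → b ≤ v → v < b′ → ∑ₗ (allLists n b′) (λ w → H (v ∷ w)) ≡ + 0
  ∑-allLists-vanish v b≤v v<b′ = trans
    (∑-allLists-cong n b′ (λ w len w<b′ → e (v ∷ w) (cong suc len) (v<b′ ∷ w<b′) (here b≤v)))
    (∑ₗ-zero (allLists n b′))

-- Catalan words

lastLetter-∷ʳ : ∀ w v → lastLetter (w ∷ʳ v) ≡ v
lastLetter-∷ʳ []           v = refl
lastLetter-∷ʳ (x ∷ [])     v = refl
lastLetter-∷ʳ (x ∷ y ∷ ws) v = lastLetter-∷ʳ (y ∷ ws) v

All-lastLetter : ∀ {P : ℕ → Set} x ws → All P (x ∷ ws) → P (lastLetter (x ∷ ws))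
All-lastLetter x []       (px ∷ _)  = px
All-lastLetter x (y ∷ ws) (_ ∷ pws) = All-lastLetter y ws pws

catTail-∷ʳ : ∀ p ws v → catTail p (ws ∷ʳ v) ≡ catTail p ws ∧ (v ℕ.≤ᵇ suc (lastLetter (p ∷ ws)))
catTail-∷ʳ p []       v = Bool.∧-comm (v ℕ.≤ᵇ suc p) true
catTail-∷ʳ p (x ∷ ws) v = trans (cong ((x ℕ.≤ᵇ suc p) ∧_) (catTail-∷ʳ x ws v))
                               (sym (Bool.∧-assoc (x ℕ.≤ᵇ suc p) (catTail x ws) _))

isCatalan-∷ʳ : ∀ x ws v →
  isCatalan ((x ∷ ws) ∷ʳ v) ≡ isCatalan (x ∷ ws) ∧ (v ℕ.≤ᵇ suc (lastLetter (x ∷ ws)))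
isCatalan-∷ʳ x ws v = trans (cong ((x ℕ.≡ᵇ 0) ∧_) (catTail-∷ʳ x ws v))
                            (sym (Bool.∧-assoc (x ℕ.≡ᵇ 0) (catTail x ws) _))

catTail-bounded : ∀ p ws → T (catTail p ws) → All (_≤ p ℕ.+ length ws) ws
catTail-bounded p []       _ = []
catTail-bounded p (x ∷ ws) t with x≤ᵇ1+p , rest ← Equivalence.to Bool.T-∧ t =
  x≤p+len ∷ All.map (λ y≤x+len → ℕ.≤-trans y≤x+len x+len≤p+len) (catTail-bounded x ws rest)
  where
  x≤1+p : x ≤ suc p
  x≤1+p = ℕ.≤ᵇ⇒≤ x (suc p) x≤ᵇ1+p
  p+len≡ : p ℕ.+ length (x ∷ ws) ≡ suc (p ℕ.+ length ws)
  p+len≡ = ℕ.+-suc p (length ws)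
  x≤p+len : x ≤ p ℕ.+ length (x ∷ ws)
  x≤p+len = subst (x ≤_) (sym p+len≡) (ℕ.≤-trans x≤1+p (s≤s (ℕ.m≤m+n p (length ws))))
  x+len≤p+len : x ℕ.+ length ws ≤ p ℕ.+ length (x ∷ ws)
  x+len≤p+len = subst (x ℕ.+ length ws ≤_) (sym p+len≡) (ℕ.+-monoˡ-≤ (length ws) x≤1+p)

isCatalan-bounded : ∀ w → T (isCatalan w) → All (_< length w) w
isCatalan-bounded (x ∷ ws) t with x≡ᵇ0 , rest ← Equivalence.to Bool.T-∧ t
  rewrite ℕ.≡ᵇ⇒≡ x 0 x≡ᵇ0 = s≤s z≤n ∷ All.map s≤s (catTail-bounded 0 ws rest)

bckFrom-∷ʳ : ∀ c ws v → bckFrom c (ws ∷ʳ v) ≡ bckFrom c ws ℕ.+ blackInColumn (c ℕ.+ length ws) v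
bckFrom-∷ʳ c []       v = trans (ℕ.+-identityʳ _) (cong (λ z → blackInColumn z v) (sym (ℕ.+-identityʳ c)))
bckFrom-∷ʳ c (x ∷ ws) v = begin
  blackInColumn c x ℕ.+ bckFrom (suc c) (ws ∷ʳ v)
    ≡⟨ cong (blackInColumn c x ℕ.+_) (bckFrom-∷ʳ (suc c) ws v) ⟩
  blackInColumn c x ℕ.+ (bckFrom (suc c) ws ℕ.+ blackInColumn (suc c ℕ.+ length ws) v)
    ≡⟨ ℕ.+-assoc (blackInColumn c x) _ _ ⟨
  bckFrom c (x ∷ ws) ℕ.+ blackInColumn (suc c ℕ.+ length ws) v
    ≡⟨ cong (λ z → bckFrom c (x ∷ ws) ℕ.+ blackInColumn z v) (ℕ.+-suc c (length ws)) ⟨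
  bckFrom c (x ∷ ws) ℕ.+ blackInColumn (c ℕ.+ length (x ∷ ws)) v ∎
  where open ≡.≡-Reasoning

𝟙ᵇ : Bool → ℤ
𝟙ᵇ true  = + 1
𝟙ᵇ false = + 0

𝟙ᵇ-∧ : ∀ a b → 𝟙ᵇ (a ∧ b) ≡ 𝟙ᵇ a ℤ.* 𝟙ᵇ b
𝟙ᵇ-∧ true  true  = refl
𝟙ᵇ-∧ true  false = refl
𝟙ᵇ-∧ false b     = refl

∑-catalanWords : ∀ n F →
  ∑ₗ (catalanWords n) F ≡ ∑ₗ (allLists n n) (λ w → 𝟙ᵇ (isCatalan w) ℤ.* F w)
∑-catalanWords n F = trans (∑ₗ-filter (λ w → isCatalan w Bool.≟ true) (allLists n n) F)
                           (∑ₗ-cong (allLists n n) (λ w → cong (ℤ._* F w) (𝟙-≟true (isCatalan w))))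
  where
  𝟙-≟true : ∀ b → 𝟙 (b Bool.≟ true) ≡ 𝟙ᵇ b
  𝟙-≟true true  = refl
  𝟙-≟true false = refl

∑-catalanWords-cong : ∀ n {F G} → (∀ w → length w ≡ n → T (isCatalan w) → F w ≡ G w) →
  ∑ₗ (catalanWords n) F ≡ ∑ₗ (catalanWords n) G
∑-catalanWords-cong n {F} {G} e = begin
  ∑ₗ (catalanWords n) F
    ≡⟨ ∑-catalanWords n F ⟩
  ∑ₗ (allLists n n) (λ w → 𝟙ᵇ (isCatalan w) ℤ.* F w)
    ≡⟨ ∑-allLists-cong n n (λ w len _ → on-catalan w len) ⟩
  ∑ₗ (allLists n n) (λ w → 𝟙ᵇ (isCatalan w) ℤ.* G w)
    ≡⟨ ∑-catalanWords n G ⟨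
  ∑ₗ (catalanWords n) G ∎
  where
  open ≡.≡-Reasoning
  on-catalan : ∀ w → length w ≡ n → 𝟙ᵇ (isCatalan w) ℤ.* F w ≡ 𝟙ᵇ (isCatalan w) ℤ.* G w
  on-catalan w len with isCatalan w in eq
  ... | true  = cong (+ 1 ℤ.*_) (e w len (subst T (sym eq) _))
  ... | false = refl

𝟙ᵇ-≤ᵇ : ∀ {v h} → v ≤ h → 𝟙ᵇ (v ℕ.≤ᵇ h) ≡ + 1
𝟙ᵇ-≤ᵇ {v} {h} v≤h with v ℕ.≤ᵇ h in eq
... | true  = refl
... | false = ⊥-elim (subst T eq (ℕ.≤⇒≤ᵇ v≤h))

𝟙ᵇ-≰ᵇ : ∀ {v h} → h < v → 𝟙ᵇ (v ℕ.≤ᵇ h) ≡ + 0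
𝟙ᵇ-≰ᵇ {v} {h} h<v with v ℕ.≤ᵇ h in eq
... | false = refl
... | true  = ⊥-elim (ℕ.<⇒≱ h<v (ℕ.≤ᵇ⇒≤ v h (subst T (sym eq) _)))

∑ₗ-upTo-≤ᵇ : ∀ {h b} f → h ≤ b → ∑ₗ (upTo (suc b)) (λ v → 𝟙ᵇ (v ℕ.≤ᵇ h) ℤ.* f v) ≡ sumTo h f
∑ₗ-upTo-≤ᵇ {h} {b} f h≤b = begin
  ∑ₗ (upTo (suc b)) (λ v → 𝟙ᵇ (v ℕ.≤ᵇ h) ℤ.* f v)
    ≡⟨ ∑ₗ-upTo-extend (suc b) _ (s≤s h≤b) (λ v h<v _ → cong (ℤ._* f v) (𝟙ᵇ-≰ᵇ h<v)) ⟩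
  ∑ₗ (upTo (suc h)) (λ v → 𝟙ᵇ (v ℕ.≤ᵇ h) ℤ.* f v)
    ≡⟨ ∑ₗ-upTo-cong (suc h) (λ v v<1+h →
         trans (cong (ℤ._* f v) (𝟙ᵇ-≤ᵇ (ℕ.≤-pred v<1+h))) (ℤ.*-identityˡ (f v))) ⟩
  ∑ₗ (upTo (suc h)) f
    ≡⟨ ∑ₗ-upTo h f ⟩
  sumTo h f ∎
  where open ≡.≡-Reasoning

𝟙ᵇ-isCatalan-≥length : ∀ {n} w → length w ≡ n → Any (n ≤_) w → 𝟙ᵇ (isCatalan w) ≡ + 0
𝟙ᵇ-isCatalan-≥length {n} w len big with isCatalan w in eq
... | false = refl
... | true  = ⊥-elim (All¬⇒¬Any (All.map ℕ.<⇒≱ w<n) big)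
  where
  w<n : All (_< n) w
  w<n = subst (λ l → All (_< l) w) len (isCatalan-bounded w (subst T (sym eq) _))

∑-catalan-extensions : ∀ {n} w (F : List ℕ → ℤ) → length w ≡ suc n →
  ∑ₗ (upTo (suc (suc n))) (λ v → 𝟙ᵇ (isCatalan (w ∷ʳ v)) ℤ.* F (w ∷ʳ v)) ≡
  𝟙ᵇ (isCatalan w) ℤ.* sumTo (suc (lastLetter w)) (λ v → F (w ∷ʳ v))
∑-catalan-extensions {n} (x ∷ ws) F len = begin
  ∑ₗ (upTo (suc (suc n))) (λ v → 𝟙ᵇ (isCatalan (w ∷ʳ v)) ℤ.* F (w ∷ʳ v))
    ≡⟨ ∑ₗ-cong (upTo (suc (suc n))) split ⟩
  ∑ₗ (upTo (suc (suc n))) (λ v → 𝟙ᵇ (isCatalan w) ℤ.* (𝟙ᵇ (v ℕ.≤ᵇ suc h) ℤ.* F (w ∷ʳ v)))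
    ≡⟨ ∑ₗ-distribˡ-* (upTo (suc (suc n))) (𝟙ᵇ (isCatalan w)) _ ⟩
  𝟙ᵇ (isCatalan w) ℤ.* ∑ₗ (upTo (suc (suc n))) (λ v → 𝟙ᵇ (v ℕ.≤ᵇ suc h) ℤ.* F (w ∷ʳ v))
    ≡⟨ truncate (isCatalan w) refl ⟩
  𝟙ᵇ (isCatalan w) ℤ.* sumTo (suc h) (λ v → F (w ∷ʳ v)) ∎
  where
  open ≡.≡-Reasoning
  w : List ℕ
  w = x ∷ ws
  h : ℕ
  h = lastLetter w
  split : ∀ v → 𝟙ᵇ (isCatalan (w ∷ʳ v)) ℤ.* F (w ∷ʳ v) ≡
                𝟙ᵇ (isCatalan w) ℤ.* (𝟙ᵇ (v ℕ.≤ᵇ suc h) ℤ.* F (w ∷ʳ v))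
  split v = trans (cong (λ b → 𝟙ᵇ b ℤ.* F (w ∷ʳ v)) (isCatalan-∷ʳ x ws v))
    (trans (cong (ℤ._* F (w ∷ʳ v)) (𝟙ᵇ-∧ (isCatalan w) _)) (ℤ.*-assoc (𝟙ᵇ (isCatalan w)) _ _))
  truncate : ∀ b → isCatalan w ≡ b →
    𝟙ᵇ b ℤ.* ∑ₗ (upTo (suc (suc n))) (λ v → 𝟙ᵇ (v ℕ.≤ᵇ suc h) ℤ.* F (w ∷ʳ v)) ≡
    𝟙ᵇ b ℤ.* sumTo (suc h) (λ v → F (w ∷ʳ v))
  truncate false _  = refl
  truncate true  eq = cong (+ 1 ℤ.*_) (∑ₗ-upTo-≤ᵇ (λ v → F (w ∷ʳ v)) (s≤s h≤n))
    where
    h≤n : h ≤ n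
    h≤n = ℕ.≤-pred (subst (h <_) len (All-lastLetter x ws (isCatalan-bounded w (subst T (sym eq) _))))

∑-catalanWords-∷ʳ : ∀ n (F : List ℕ → ℤ) →
  ∑ₗ (catalanWords (suc (suc n))) F ≡
  ∑ₗ (catalanWords (suc n)) (λ w → sumTo (suc (lastLetter w)) (λ v → F (w ∷ʳ v)))
∑-catalanWords-∷ʳ n F = begin
  ∑ₗ (catalanWords (suc (suc n))) F
    ≡⟨ ∑-catalanWords (suc (suc n)) F ⟩
  ∑ₗ (allLists (suc (suc n)) (suc (suc n))) (λ w → 𝟙ᵇ (isCatalan w) ℤ.* F w)
    ≡⟨ ∑-allLists-∷ʳ (suc n) (suc (suc n)) _ ⟩
  ∑ₗ (allLists (suc n) (suc (suc n)))
     (λ w → ∑ₗ (upTo (suc (suc n))) (λ v → 𝟙ᵇ (isCatalan (w ∷ʳ v)) ℤ.* F (w ∷ʳ v)))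
    ≡⟨ ∑-allLists-cong (suc n) (suc (suc n)) (λ w len _ → ∑-catalan-extensions w F len) ⟩
  ∑ₗ (allLists (suc n) (suc (suc n))) (λ w → 𝟙ᵇ (isCatalan w) ℤ.* S w)
    ≡⟨ ∑-allLists-restrict (suc n) _ (ℕ.n≤1+n (suc n))
         (λ w len _ big → cong (ℤ._* S w) (𝟙ᵇ-isCatalan-≥length w len big)) ⟩
  ∑ₗ (allLists (suc n) (suc n)) (λ w → 𝟙ᵇ (isCatalan w) ℤ.* S w)
    ≡⟨ ∑-catalanWords (suc n) S ⟨
  ∑ₗ (catalanWords (suc n)) S ∎
  where
  open ≡.≡-Reasoning
  S : List ℕ → ℤ
  S w = sumTo (suc (lastLetter w)) (λ v → F (w ∷ʳ v))

𝟙even : ℕ → ℕ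
𝟙even x = 𝟙ℕ (x % 2 ℕ.≟ 0)

-- The number of black cells in a column of height v + 1 whose index has parity a.
blackCells : ℕ → ℕ → ℕ
blackCells a zero          = 𝟙ℕ (a ℕ.≟ 0)
blackCells a (suc zero)    = 1
blackCells a (suc (suc v)) = suc (blackCells a v)

length-filter-[_] : ∀ {A : Set} {P : A → Set} (x : A) (P? : ∀ x → Dec (P x)) →
  length (filter P? [ x ]) ≡ 𝟙ℕ (P? x)
length-filter-[ x ] P? with P? x
... | yes _ = refl
... | no _  = refl

blackInColumn-suc : ∀ c v → blackInColumn c (suc v) ≡ blackInColumn c v ℕ.+ 𝟙even (suc v ℕ.+ c)
blackInColumn-suc c v = begin
  length (filter P? (upTo (suc (suc v))))
    ≡⟨ cong (λ l → length (filter P? l)) (List.upTo-∷ʳ (suc v)) ⟨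
  length (filter P? (upTo (suc v) ++ [ suc v ]))
    ≡⟨ cong length (List.filter-++ P? (upTo (suc v)) [ suc v ]) ⟩
  length (filter P? (upTo (suc v)) ++ filter P? [ suc v ])
    ≡⟨ List.length-++ (filter P? (upTo (suc v))) ⟩
  blackInColumn c v ℕ.+ length (filter P? [ suc v ])
    ≡⟨ cong (blackInColumn c v ℕ.+_) (length-filter-[ suc v ] P?) ⟩
  blackInColumn c v ℕ.+ 𝟙even (suc v ℕ.+ c) ∎
  where
  open ≡.≡-Reasoning
  P? : ∀ h → Dec ((h ℕ.+ c) % 2 ≡ 0)
  P? h = (h ℕ.+ c) % 2 ℕ.≟ 0

𝟙even-pair : ∀ x → 𝟙even x ℕ.+ 𝟙even (suc x) ≡ 1
𝟙even-pair zero          = refl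
𝟙even-pair (suc zero)    = refl
𝟙even-pair (suc (suc x)) = 𝟙even-pair x

blackInColumn≡blackCells : ∀ c v → blackInColumn c v ≡ blackCells (c % 2) v
blackInColumn≡blackCells c zero = length-filter-[ 0 ] (λ h → (h ℕ.+ c) % 2 ℕ.≟ 0)
blackInColumn≡blackCells c (suc zero) = begin
  blackInColumn c 1                    ≡⟨ blackInColumn-suc c 0 ⟩
  blackInColumn c 0 ℕ.+ 𝟙even (suc c)  ≡⟨ cong (ℕ._+ 𝟙even (suc c)) (blackInColumn≡blackCells c 0) ⟩
  𝟙even c ℕ.+ 𝟙even (suc c)            ≡⟨ 𝟙even-pair c ⟩
  1                                    ∎
  where open ≡.≡-Reasoning
blackInColumn≡blackCells c (suc (suc v)) = begin
  blackInColumn c (2 ℕ.+ v)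
    ≡⟨ blackInColumn-suc c (suc v) ⟩
  blackInColumn c (1 ℕ.+ v) ℕ.+ 𝟙even (2 ℕ.+ v ℕ.+ c)
    ≡⟨ cong (ℕ._+ 𝟙even (2 ℕ.+ v ℕ.+ c)) (blackInColumn-suc c v) ⟩
  blackInColumn c v ℕ.+ 𝟙even (1 ℕ.+ v ℕ.+ c) ℕ.+ 𝟙even (2 ℕ.+ v ℕ.+ c)
    ≡⟨ ℕ.+-assoc (blackInColumn c v) _ _ ⟩
  blackInColumn c v ℕ.+ (𝟙even (1 ℕ.+ v ℕ.+ c) ℕ.+ 𝟙even (2 ℕ.+ v ℕ.+ c))
    ≡⟨ cong (blackInColumn c v ℕ.+_) (𝟙even-pair (suc v ℕ.+ c)) ⟩
  blackInColumn c v ℕ.+ 1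
    ≡⟨ ℕ.+-comm (blackInColumn c v) 1 ⟩
  suc (blackInColumn c v)
    ≡⟨ cong suc (blackInColumn≡blackCells c v) ⟩
  suc (blackCells (c % 2) v) ∎
  where open ≡.≡-Reasoning

bck-∷ʳ : ∀ {c} w v → length w ≡ c → bck (w ∷ʳ v) ≡ bck w ℕ.+ blackCells (c % 2) v
bck-∷ʳ {c} w v len = trans (bckFrom-∷ʳ 0 w v)
  (cong (bck w ℕ.+_) (trans (cong (λ c′ → blackInColumn c′ v) len) (blackInColumn≡blackCells c v)))

-- G_ab(x,u,q) = (√u)^b F_ab(x,√u,q) weighs P by u^⌈last(P)/2⌉, and last(P) = lastLetter + 1.
uDegree : List ℕ → ℕ
uDegree w = suc ⌊ lastLetter w /2⌋

-- g k is G(x, q^k, q); g 0 is 𝐆₁ by definition.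
g : ℕ → Vec4
g k i n m = + length (filter (λ w → (n % 2 ℕ.≟ parA i) ×-dec (suc (lastLetter w) % 2 ℕ.≟ parB i)
                                     ×-dec (k ℕ.* uDegree w ℕ.+ bck w ℕ.≟ m))
                             (catalanWords n))

inClass : Fin 4 → ℕ → ℕ → ℤ
inClass i a b = 𝟙 (a ℕ.≟ parA i) ℤ.* 𝟙 (b ℕ.≟ parB i)

𝟙-×-dec : ∀ {A B : Set} (a : Dec A) (b : Dec B) → 𝟙 (a ×-dec b) ≡ 𝟙 a ℤ.* 𝟙 b
𝟙-×-dec (yes _) (yes _) = refl
𝟙-×-dec (yes _) (no _)  = refl
𝟙-×-dec (no _)  _       = refl

g-coeff : ∀ k i n m → g k i n m ≡
  ∑ₗ (catalanWords n)
     (λ w → inClass i (n % 2) (suc (lastLetter w) % 2) ℤ.* δ m (k ℕ.* uDegree w ℕ.+ bck w))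
g-coeff k i n m = trans (length-filter≡∑ₗ _ (catalanWords n)) (∑ₗ-cong (catalanWords n) λ w →
  trans (𝟙-×-dec (n % 2 ℕ.≟ parA i) _)
  (trans (cong (𝟙 (n % 2 ℕ.≟ parA i) ℤ.*_) (𝟙-×-dec (suc (lastLetter w) % 2 ℕ.≟ parB i) _))
         (sym (ℤ.*-assoc (𝟙 (n % 2 ℕ.≟ parA i)) _ _))))

-- M and N are nonzero exactly where appending a column flips the parity of the length.
support : Fin 4 → Fin 4 → ℤ
support i j = 𝟙 (parA i ℕ.≟ 1 ∸ parA j)

-- The q-exponents of the numerators x u^a q^b of M(x, q^k, q) and N(x, q^k, q).
Mexp Nexp : ℕ → Fin 4 → Fin 4 → ℕ
Mexp k 0F 2F = suc k
Mexp k 0F 3F = suc k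
Mexp k 1F 2F = suc (k ℕ.+ k)
Mexp k 1F 3F = k
Mexp k 2F 0F = suc k
Mexp k 2F 1F = suc k
Mexp k 3F 0F = suc (suc (k ℕ.+ k))
Mexp k 3F 1F = suc k
Mexp k _  _  = 0
Nexp k 1F _ = k
Nexp k _  _ = suc k

-- The contribution of w ∷ʳ v to [q^m] (g k) i, where w has length c and β black cells.
extensionTerm : (c k m β : ℕ) → Fin 4 → ℕ → ℤ
extensionTerm c k m β i v =
  inClass i (suc c % 2) (suc v % 2) ℤ.* δ m (k ℕ.* suc ⌊ v /2⌋ ℕ.+ (β ℕ.+ blackCells (c % 2) v))

-- The contribution of a word of length c, with β black cells and last letter h, to [q^m] of
-- the j-th summand of (numerator e ⊙ g k) i.
numeratorTerm : (Fin 4 → Fin 4 → ℕ) → (k c m β h : ℕ) → Fin 4 → Fin 4 → ℤ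
numeratorTerm e k c m β h i j =
  support i j ℤ.* (inClass j (c % 2) (suc h % 2) ℤ.* δ m (k ℕ.* suc ⌊ h /2⌋ ℕ.+ β ℕ.+ e i j))

Mterm Nterm : (c k m β h : ℕ) → Fin 4 → Fin 4 → ℤ
Mterm c k = numeratorTerm (Mexp k) (suc k) c
Nterm c k = numeratorTerm (Nexp k) 0 c

private
  δ-case : ∀ {l r : ℤ} {m E E′} → l ≡ δ m E → r ≡ δ m E′ → E ≡ E′ → l ≡ r
  δ-case {m = m} l≡ r≡ E≡E′ = trans l≡ (trans (cong (δ m) E≡E′) (sym r≡))

  first₂ : ∀ x → + 1 ℤ.* x ℤ.+ + 0 ≡ x
  first₂ = ℤ-Solver.solve-∀
  second₂ : ∀ x → + 0 ℤ.+ + 1 ℤ.* x ≡ x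
  second₂ = ℤ-Solver.solve-∀
  first₄ : ∀ x → ((+ 1 ℤ.* (+ 1 ℤ.* x) ℤ.+ + 0) ℤ.+ + 0) ℤ.+ + 0 ≡ x
  first₄ = ℤ-Solver.solve-∀
  second₄ : ∀ x → ((+ 0 ℤ.+ + 1 ℤ.* (+ 1 ℤ.* x)) ℤ.+ + 0) ℤ.+ + 0 ≡ x
  second₄ = ℤ-Solver.solve-∀
  third₄ : ∀ x → ((+ 0 ℤ.+ + 0) ℤ.+ + 1 ℤ.* (+ 1 ℤ.* x)) ℤ.+ + 0 ≡ x
  third₄ = ℤ-Solver.solve-∀
  fourth₄ : ∀ x → ((+ 0 ℤ.+ + 0) ℤ.+ + 0) ℤ.+ + 1 ℤ.* (+ 1 ℤ.* x) ≡ x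
  fourth₄ = ℤ-Solver.solve-∀

  exponent-M-xuq : ∀ k β → k ℕ.* 2 ℕ.+ (β ℕ.+ 2) ≡ suc k ℕ.* 1 ℕ.+ β ℕ.+ suc k
  exponent-M-xuq = ℕ-Solver.solve-∀
  exponent-M-xu²q² : ∀ k β → k ℕ.* 3 ℕ.+ (β ℕ.+ 3) ≡ suc k ℕ.* 1 ℕ.+ β ℕ.+ suc (suc (k ℕ.+ k))
  exponent-M-xu²q² = ℕ-Solver.solve-∀
  exponent-M-xu : ∀ k β → k ℕ.* 2 ℕ.+ (β ℕ.+ 1) ≡ suc k ℕ.* 1 ℕ.+ β ℕ.+ k
  exponent-M-xu = ℕ-Solver.solve-∀
  exponent-M-xu²q : ∀ k β → k ℕ.* 3 ℕ.+ (β ℕ.+ 2) ≡ suc k ℕ.* 1 ℕ.+ β ℕ.+ suc (k ℕ.+ k)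
  exponent-M-xu²q = ℕ-Solver.solve-∀
  exponent-N-xuq : ∀ k β → k ℕ.* 1 ℕ.+ (β ℕ.+ 1) ≡ β ℕ.+ suc k
  exponent-N-xuq = ℕ-Solver.solve-∀
  exponent-N-xu : ∀ k β → k ℕ.* 1 ℕ.+ (β ℕ.+ 0) ≡ β ℕ.+ k
  exponent-N-xu = ℕ-Solver.solve-∀

extensionTerm-+2 : ∀ c k m β i v →
  extensionTerm c k m β i (suc (suc v)) ≡ extensionTerm c k m (β ℕ.+ suc k) i v
extensionTerm-+2 c k m β i v = cong (λ E → inClass i (suc c % 2) (suc v % 2) ℤ.* δ m E)
  (exponent k ⌊ v /2⌋ β (blackCells (c % 2) v))
  where
  exponent : ∀ k x β y → k ℕ.* suc (suc x) ℕ.+ (β ℕ.+ suc y) ≡ k ℕ.* suc x ℕ.+ ((β ℕ.+ suc k) ℕ.+ y)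
  exponent = ℕ-Solver.solve-∀

Mterm-+2 : ∀ c k m β h i j → Mterm c k m β (suc (suc h)) i j ≡ Mterm c k m (β ℕ.+ suc k) h i j
Mterm-+2 c k m β h i j = cong (λ E → support i j ℤ.* (inClass j (c % 2) (suc h % 2) ℤ.* δ m E))
  (exponent k ⌊ h /2⌋ β (Mexp k i j))
  where
  exponent : ∀ k x β s → suc k ℕ.* suc (suc x) ℕ.+ β ℕ.+ s ≡ suc k ℕ.* suc x ℕ.+ (β ℕ.+ suc k) ℕ.+ s
  exponent = ℕ-Solver.solve-∀

-- A finite check: on each side at most one summand survives, with the same exponent.
extensions-top : ∀ c k m i h β →
  extensionTerm c k m β i (suc (suc h)) ℤ.+ extensionTerm c k m β i (suc (suc (suc h))) ≡
  ∑₄ (Mterm c k m β h i)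
extensions-top 0 k m 0F 0 β = refl
extensions-top 0 k m 1F 0 β = refl
extensions-top 0 k m 2F 0 β = δ-case (second₂ _) (second₄ _) (exponent-M-xuq k β)
extensions-top 0 k m 3F 0 β = δ-case (first₂ _)  (second₄ _) (exponent-M-xuq k β)
extensions-top 0 k m 0F 1 β = refl
extensions-top 0 k m 1F 1 β = refl
extensions-top 0 k m 2F 1 β = δ-case (first₂ _)  (first₄ _)  (exponent-M-xuq k β)
extensions-top 0 k m 3F 1 β = δ-case (second₂ _) (first₄ _)  (exponent-M-xu²q² k β)
extensions-top 1 k m 0F 0 β = δ-case (second₂ _) (fourth₄ _) (exponent-M-xuq k β)
extensions-top 1 k m 1F 0 β = δ-case (first₂ _)  (fourth₄ _) (exponent-M-xu k β)
extensions-top 1 k m 2F 0 β = refl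
extensions-top 1 k m 3F 0 β = refl
extensions-top 1 k m 0F 1 β = δ-case (first₂ _)  (third₄ _)  (exponent-M-xuq k β)
extensions-top 1 k m 1F 1 β = δ-case (second₂ _) (third₄ _)  (exponent-M-xu²q k β)
extensions-top 1 k m 2F 1 β = refl
extensions-top 1 k m 3F 1 β = refl
extensions-top c k m i (suc (suc h)) β = begin
  extensionTerm c k m β i (4 ℕ.+ h) ℤ.+ extensionTerm c k m β i (5 ℕ.+ h)
    ≡⟨ cong₂ ℤ._+_ (extensionTerm-+2 c k m β i (2 ℕ.+ h)) (extensionTerm-+2 c k m β i (3 ℕ.+ h)) ⟩
  extensionTerm c k m (β ℕ.+ suc k) i (2 ℕ.+ h) ℤ.+ extensionTerm c k m (β ℕ.+ suc k) i (3 ℕ.+ h)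
    ≡⟨ extensions-top c k m i h (β ℕ.+ suc k) ⟩
  ∑₄ (Mterm c k m (β ℕ.+ suc k) h i)
    ≡⟨ ∑₄-cong (Mterm-+2 c k m β h i) ⟨
  ∑₄ (Mterm c k m β (2 ℕ.+ h) i) ∎
  where open ≡.≡-Reasoning
extensions-top (suc (suc c)) k m i h β = extensions-top c k m i h β

extensions-bottom : ∀ c k m i h β →
  extensionTerm c k m β i 0 ℤ.+ extensionTerm c k m β i 1 ≡ ∑₄ (Nterm c k m β h i)
extensions-bottom 0 k m 0F 0 β = refl
extensions-bottom 0 k m 1F 0 β = refl
extensions-bottom 0 k m 2F 0 β = δ-case (second₂ _) (second₄ _) (exponent-N-xuq k β)
extensions-bottom 0 k m 3F 0 β = δ-case (first₂ _)  (second₄ _) (exponent-N-xuq k β)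
extensions-bottom 0 k m 0F 1 β = refl
extensions-bottom 0 k m 1F 1 β = refl
extensions-bottom 0 k m 2F 1 β = δ-case (second₂ _) (first₄ _)  (exponent-N-xuq k β)
extensions-bottom 0 k m 3F 1 β = δ-case (first₂ _)  (first₄ _)  (exponent-N-xuq k β)
extensions-bottom 1 k m 0F 0 β = δ-case (second₂ _) (fourth₄ _) (exponent-N-xuq k β)
extensions-bottom 1 k m 1F 0 β = δ-case (first₂ _)  (fourth₄ _) (exponent-N-xu k β)
extensions-bottom 1 k m 2F 0 β = refl
extensions-bottom 1 k m 3F 0 β = refl
extensions-bottom 1 k m 0F 1 β = δ-case (second₂ _) (third₄ _)  (exponent-N-xuq k β)
extensions-bottom 1 k m 1F 1 β = δ-case (first₂ _)  (third₄ _)  (exponent-N-xu k β)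
extensions-bottom 1 k m 2F 1 β = refl
extensions-bottom 1 k m 3F 1 β = refl
extensions-bottom c k m i (suc (suc h)) β = extensions-bottom c k m i h β
extensions-bottom (suc (suc c)) k m i h β = extensions-bottom c k m i h β

extensions-telescope : ∀ c k m i h β →
  sumTo (suc h) (λ v → extensionTerm c k m β i v ℤ.- extensionTerm c k m β i (suc (suc v))) ≡
  ℤ.- ∑₄ (Mterm c k m β h i) ℤ.+ ∑₄ (Nterm c k m β h i)
extensions-telescope c k m i h β = begin
  sumTo (suc h) (λ v → extensionTerm c k m β i v ℤ.- extensionTerm c k m β i (suc (suc v)))
    ≡⟨ sumTo-telescope₂ (extensionTerm c k m β i) h ⟩
  (extensionTerm c k m β i 0 ℤ.+ extensionTerm c k m β i 1) ℤ.-
  (extensionTerm c k m β i (2 ℕ.+ h) ℤ.+ extensionTerm c k m β i (3 ℕ.+ h))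
    ≡⟨ cong₂ ℤ._-_ (extensions-bottom c k m i h β) (extensions-top c k m i h β) ⟩
  ∑₄ (Nterm c k m β h i) ℤ.- ∑₄ (Mterm c k m β h i)
    ≡⟨ ℤ.+-comm (∑₄ (Nterm c k m β h i)) _ ⟩
  ℤ.- ∑₄ (Mterm c k m β h i) ℤ.+ ∑₄ (Nterm c k m β h i) ∎
  where open ≡.≡-Reasoning

-- The functional equation

q^suc≈ : ∀ k → Q *ˢ Q ^ˢ k ≈ˢ monomial 0 (suc k)
q^suc≈ k = *ˢ-monomials Q≈monomial (Q^≈monomial k) refl refl

XQ^k≈ : ∀ k → X *ˢ Q ^ˢ k ≈ˢ monomial 1 k
XQ^k≈ k = *ˢ-monomials X≈monomial (Q^≈monomial k) refl refl

XQ^kQ≈ : ∀ k → X *ˢ Q ^ˢ k *ˢ Q ≈ˢ monomial 1 (suc k)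
XQ^kQ≈ k = *ˢ-monomials (XQ^k≈ k) Q≈monomial refl (ℕ.+-comm k 1)

Q^k²≈ : ∀ k → (Q ^ˢ k) ^ˢ 2 ≈ˢ monomial 0 (k ℕ.+ k)
Q^k²≈ k = *ˢ-monomials (*ˢ-monomials 1ˢ≈monomial (Q^≈monomial k) refl refl) (Q^≈monomial k) refl refl

XQ^k²Q≈ : ∀ k → X *ˢ (Q ^ˢ k) ^ˢ 2 *ˢ Q ≈ˢ monomial 1 (suc (k ℕ.+ k))
XQ^k²Q≈ k =
  *ˢ-monomials (*ˢ-monomials X≈monomial (Q^k²≈ k) refl refl) Q≈monomial refl (ℕ.+-comm (k ℕ.+ k) 1)

XQ^k²Q²≈ : ∀ k → X *ˢ (Q ^ˢ k) ^ˢ 2 *ˢ Q ^ˢ 2 ≈ˢ monomial 1 (suc (suc (k ℕ.+ k)))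
XQ^k²Q²≈ k =
  *ˢ-monomials (*ˢ-monomials X≈monomial (Q^k²≈ k) refl refl) (Q^≈monomial 2) refl (ℕ.+-comm (k ℕ.+ k) 2)

-- over[qu-1] (Q ^ˢ k) f is -ˢ (f *ˢ inverse k).
denominator : ℕ → Series
denominator k = 1ˢ +ˢ -ˢ (Q *ˢ Q ^ˢ k)

inverse : ℕ → Series
inverse k = inv1- (Q *ˢ Q ^ˢ k)

inverse-denominator : ∀ k → inverse k *ˢ denominator k ≈ˢ 1ˢ
inverse-denominator k = ≈ˢ-trans (*-comm (inverse k) (denominator k)) (inv1-‿inverse (Q *ˢ Q ^ˢ k) small)
  where
  small : ∀ t n m → n ℕ.+ m < t → ((Q *ˢ Q ^ˢ k) ^ˢ t) n m ≡ + 0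
  small t n m n+m<t = trans (≈ˢ-trans (^ˢ-cong t (q^suc≈ k)) (monomial-^ 0 (suc k) t) n m)
    (trans (cong (δ (t ℕ.* 0) n ℤ.*_) (δ-< m<t*[1+k])) (ℤ.*-zeroʳ (δ (t ℕ.* 0) n)))
    where
    m<t*[1+k] : m < t ℕ.* suc k
    m<t*[1+k] = ℕ.<-≤-trans (ℕ.≤-<-trans (ℕ.m≤n+m m n) n+m<t) (ℕ.m≤m*n t (suc k))

denominator-*ˢ : ∀ k f → denominator k *ˢ f ≈ˢ f +ˢ -ˢ (monomial 0 (suc k) *ˢ f)
denominator-*ˢ k f = ≈ˢ-trans (distribʳ f 1ˢ (-ˢ (Q *ˢ Q ^ˢ k)))
  (+-cong (*-identityˡ f)
          (≈ˢ-trans (≈ˢ-sym (-‿distribˡ-* (Q *ˢ Q ^ˢ k) f)) (-‿cong (*-congʳ {f} (q^suc≈ k)))))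

numerator : (Fin 4 → Fin 4 → ℕ) → Mat
numerator e i j = support i j ∙ˢ monomial 1 (e i j)

Mnum Nnum : ℕ → Mat
Mnum k = numerator (Mexp k)
Nnum k = numerator (Nexp k)

numerator-⊙-coeff₀ : ∀ e v i m → (numerator e ⊙ v) i 0 m ≡ + 0
numerator-⊙-coeff₀ e v i m = ∑₄-cong {λ j → (numerator e i j *ˢ v j) 0 m} {λ _ → + 0} λ j →
  trans (∙ˢ-*ˢ (support i j) (monomial 1 (e i j)) (v j) 0 m)
        (trans (cong (support i j ℤ.*_) (monomial-*-coeff-<x {1} {e i j} (v j) m ℕ.z<s))
               (ℤ.*-zeroʳ (support i j)))

numerator-⊙-g-coeff : ∀ e k i n m → (numerator e ⊙ g k) i (suc n) m ≡
  ∑ₗ (catalanWords n) (λ w → ∑₄ (numeratorTerm e k n m (bck w) (lastLetter w) i))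
numerator-⊙-g-coeff e k i n m =
  trans (∑₄-cong term) (∑₄-∑ₗ (catalanWords n) (λ j w → numeratorTerm e k n m (bck w) (lastLetter w) i j))
  where
  term : ∀ j → ((numerator e i j) *ˢ g k j) (suc n) m ≡
    ∑ₗ (catalanWords n) (λ w → numeratorTerm e k n m (bck w) (lastLetter w) i j)
  term j = begin
    (support i j ∙ˢ monomial 1 (e i j) *ˢ g k j) (suc n) m
      ≡⟨ ∙ˢ-*ˢ (support i j) (monomial 1 (e i j)) (g k j) (suc n) m ⟩
    support i j ℤ.* (monomial 1 (e i j) *ˢ g k j) (suc n) m
      ≡⟨ cong (support i j ℤ.*_) (monomial-*-∑ₗδ catalanWords p wt (g-coeff k j) 1 (e i j) n m) ⟩
    support i j ℤ.* ∑ₗ (catalanWords n) (λ w → p n w ℤ.* δ m (wt w ℕ.+ e i j))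
      ≡⟨ ∑ₗ-distribˡ-* (catalanWords n) (support i j) _ ⟨
    ∑ₗ (catalanWords n) (λ w → numeratorTerm e k n m (bck w) (lastLetter w) i j) ∎
    where
    open ≡.≡-Reasoning
    p : ℕ → List ℕ → ℤ
    p n w = inClass j (n % 2) (suc (lastLetter w) % 2)
    wt : List ℕ → ℕ
    wt w = k ℕ.* uDegree w ℕ.+ bck w

-- The contribution of a word of length n to [q^m] of g k i - q^(k+1) g k i.
differenceTerm : ℕ → Fin 4 → ℕ → ℕ → List ℕ → ℤ
differenceTerm k i n m w =
  inClass i (n % 2) (suc (lastLetter w) % 2) ℤ.* δ m (k ℕ.* uDegree w ℕ.+ bck w) ℤ.-
  inClass i (n % 2) (suc (lastLetter w) % 2) ℤ.* δ m (k ℕ.* uDegree w ℕ.+ bck w ℕ.+ suc k)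

g-difference-∑ₗ : ∀ k i n m →
  g k i n m ℤ.- (monomial 0 (suc k) *ˢ g k i) n m ≡ ∑ₗ (catalanWords n) (differenceTerm k i n m)
g-difference-∑ₗ k i n m = begin
  g k i n m ℤ.- (monomial 0 (suc k) *ˢ g k i) n m
    ≡⟨ cong₂ ℤ._-_ (g-coeff k i n m) (monomial-*-∑ₗδ catalanWords p wt (g-coeff k i) 0 (suc k) n m) ⟩
  ∑ₗ (catalanWords n) plain ℤ.- ∑ₗ (catalanWords n) shifted
    ≡⟨ cong (λ s → ∑ₗ (catalanWords n) plain ℤ.+ s) (∑ₗ-neg (catalanWords n) shifted) ⟨
  ∑ₗ (catalanWords n) plain ℤ.+ ∑ₗ (catalanWords n) (λ w → ℤ.- shifted w)
    ≡⟨ ∑ₗ-distrib-+ (catalanWords n) plain (λ w → ℤ.- shifted w) ⟨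
  ∑ₗ (catalanWords n) (differenceTerm k i n m) ∎
  where
  open ≡.≡-Reasoning
  p : ℕ → List ℕ → ℤ
  p n w = inClass i (n % 2) (suc (lastLetter w) % 2)
  wt : List ℕ → ℕ
  wt w = k ℕ.* uDegree w ℕ.+ bck w
  plain shifted : List ℕ → ℤ
  plain w = p n w ℤ.* δ m (wt w)
  shifted w = p n w ℤ.* δ m (wt w ℕ.+ suc k)

differenceTerm-∷ʳ : ∀ k i n m w v → length w ≡ suc n →
  differenceTerm k i (suc (suc n)) m (w ∷ʳ v) ≡
  extensionTerm (suc n) k m (bck w) i v ℤ.- extensionTerm (suc n) k m (bck w) i (suc (suc v))
differenceTerm-∷ʳ k i n m w v len rewrite lastLetter-∷ʳ w v | bck-∷ʳ w v len =
  cong (λ E → extensionTerm (suc n) k m (bck w) i v ℤ.- inClass i (suc (suc n) % 2) (suc v % 2) ℤ.* δ m E)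
       (exponent k ⌊ v /2⌋ (bck w) (blackCells (suc n % 2) v))
  where
  exponent : ∀ k x β y → k ℕ.* suc x ℕ.+ (β ℕ.+ y) ℕ.+ suc k ≡ k ℕ.* suc (suc x) ℕ.+ (β ℕ.+ suc y)
  exponent = ℕ-Solver.solve-∀

𝐁-difference : ℕ → Fin 4 → ℕ → ℕ → ℤ
𝐁-difference k 3F n m = monomial 1 (suc k) n m ℤ.- monomial 1 (suc k ℕ.+ suc k) n m
𝐁-difference k _  n m = + 0

𝐁-difference-coeff : ∀ k i n m →
  𝐁 (Q ^ˢ k) i n m ℤ.- (monomial 0 (suc k) *ˢ 𝐁 (Q ^ˢ k) i) n m ≡ 𝐁-difference k i n m
𝐁-difference-coeff k 3F n m = cong₂ ℤ._-_ (XQ^kQ≈ k n m)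
  (*ˢ-monomials (≈ˢ-refl {monomial 0 (suc k)}) (XQ^kQ≈ k) refl refl n m)
𝐁-difference-coeff k 0F n m = cong (λ z → + 0 ℤ.- z) (zeroʳ (monomial 0 (suc k)) n m)
𝐁-difference-coeff k 1F n m = cong (λ z → + 0 ℤ.- z) (zeroʳ (monomial 0 (suc k)) n m)
𝐁-difference-coeff k 2F n m = cong (λ z → + 0 ℤ.- z) (zeroʳ (monomial 0 (suc k)) n m)

𝐁-difference-≢1 : ∀ k i {n} m → n ≢ 1 → 𝐁-difference k i n m ≡ + 0
𝐁-difference-≢1 k 0F m n≢1 = refl
𝐁-difference-≢1 k 1F m n≢1 = refl
𝐁-difference-≢1 k 2F m n≢1 = refl
𝐁-difference-≢1 k 3F m n≢1 = cong₂ (λ x y → x ℤ.* _ ℤ.- y ℤ.* _) (δ-≢ n≢1) (δ-≢ n≢1)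

differenceTerm-one-cell : ∀ k i m → differenceTerm k i 1 m [ 0 ] ℤ.+ + 0 ≡ 𝐁-difference k i 1 m
differenceTerm-one-cell k 0F m = refl
differenceTerm-one-cell k 1F m = refl
differenceTerm-one-cell k 2F m = refl
differenceTerm-one-cell k 3F m = trans (ℤ.+-identityʳ _) (cong₂ (λ x y → + 1 ℤ.* x ℤ.- + 1 ℤ.* y)
  (trans (δ-sym m _) (cong (λ E → δ E m) (exponent₁ k)))
  (trans (δ-sym m _) (cong (λ E → δ E m) (exponent₂ k))))
  where
  exponent₁ : ∀ k → k ℕ.* 1 ℕ.+ 1 ≡ suc k
  exponent₁ = ℕ-Solver.solve-∀
  exponent₂ : ∀ k → k ℕ.* 1 ℕ.+ 1 ℕ.+ suc k ≡ suc k ℕ.+ suc k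
  exponent₂ = ℕ-Solver.solve-∀

∑-differenceTerm-extensions : ∀ k i n m w → length w ≡ suc n →
  sumTo (suc (lastLetter w)) (λ v → differenceTerm k i (2 ℕ.+ n) m (w ∷ʳ v)) ≡
  ℤ.- ∑₄ (Mterm (suc n) k m (bck w) (lastLetter w) i) ℤ.+ ∑₄ (Nterm (suc n) k m (bck w) (lastLetter w) i)
∑-differenceTerm-extensions k i n m w len =
  trans (sumTo-cong (suc (lastLetter w)) (λ v → differenceTerm-∷ʳ k i n m w v len))
        (extensions-telescope (suc n) k m i (lastLetter w) (bck w))

+-𝐁-difference-≢1 : ∀ k i {n} m x → n ≢ 1 → x ℤ.+ 𝐁-difference k i n m ≡ x
+-𝐁-difference-≢1 k i m x n≢1 = trans (cong (λ b → x ℤ.+ b) (𝐁-difference-≢1 k i m n≢1)) (ℤ.+-identityʳ x)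

g-difference-coeff : ∀ k i n m →
  g k i n m ℤ.- (monomial 0 (suc k) *ˢ g k i) n m ≡
  (ℤ.- (Mnum k ⊙ g (suc k)) i n m ℤ.+ (Nnum k ⊙ g 0) i n m) ℤ.+ 𝐁-difference k i n m
g-difference-coeff k i zero m = begin
  g k i 0 m ℤ.- (monomial 0 (suc k) *ˢ g k i) 0 m
    ≡⟨ g-difference-∑ₗ k i 0 m ⟩
  + 0
    ≡⟨ cong₂ (λ x y → ℤ.- x ℤ.+ y)
             (numerator-⊙-coeff₀ (Mexp k) (g (suc k)) i m) (numerator-⊙-coeff₀ (Nexp k) (g 0) i m) ⟨
  ℤ.- (Mnum k ⊙ g (suc k)) i 0 m ℤ.+ (Nnum k ⊙ g 0) i 0 m
    ≡⟨ +-𝐁-difference-≢1 k i m _ (λ ()) ⟨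
  (ℤ.- (Mnum k ⊙ g (suc k)) i 0 m ℤ.+ (Nnum k ⊙ g 0) i 0 m) ℤ.+ 𝐁-difference k i 0 m ∎
  where open ≡.≡-Reasoning
g-difference-coeff k i (suc zero) m = begin
  g k i 1 m ℤ.- (monomial 0 (suc k) *ˢ g k i) 1 m
    ≡⟨ g-difference-∑ₗ k i 1 m ⟩
  differenceTerm k i 1 m [ 0 ] ℤ.+ + 0
    ≡⟨ differenceTerm-one-cell k i m ⟩
  𝐁-difference k i 1 m
    ≡⟨ ℤ.+-identityˡ _ ⟨
  + 0 ℤ.+ 𝐁-difference k i 1 m
    ≡⟨ cong₂ (λ x y → (ℤ.- x ℤ.+ y) ℤ.+ 𝐁-difference k i 1 m)
             (numerator-⊙-g-coeff (Mexp k) (suc k) i 0 m) (numerator-⊙-g-coeff (Nexp k) 0 i 0 m) ⟨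
  (ℤ.- (Mnum k ⊙ g (suc k)) i 1 m ℤ.+ (Nnum k ⊙ g 0) i 1 m) ℤ.+ 𝐁-difference k i 1 m ∎
  where open ≡.≡-Reasoning
g-difference-coeff k i (suc (suc n)) m = begin
  g k i (2 ℕ.+ n) m ℤ.- (monomial 0 (suc k) *ˢ g k i) (2 ℕ.+ n) m
    ≡⟨ g-difference-∑ₗ k i (2 ℕ.+ n) m ⟩
  ∑ₗ (catalanWords (2 ℕ.+ n)) (differenceTerm k i (2 ℕ.+ n) m)
    ≡⟨ ∑-catalanWords-∷ʳ n (differenceTerm k i (2 ℕ.+ n) m) ⟩
  ∑ₗ (catalanWords (1 ℕ.+ n))
     (λ w → sumTo (suc (lastLetter w)) (λ v → differenceTerm k i (2 ℕ.+ n) m (w ∷ʳ v)))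
    ≡⟨ ∑-catalanWords-cong (suc n) (λ w len _ → ∑-differenceTerm-extensions k i n m w len) ⟩
  ∑ₗ (catalanWords (1 ℕ.+ n)) (λ w → ℤ.- M w ℤ.+ N w)
    ≡⟨ ∑ₗ-distrib-+ (catalanWords (1 ℕ.+ n)) (λ w → ℤ.- M w) N ⟩
  ∑ₗ (catalanWords (1 ℕ.+ n)) (λ w → ℤ.- M w) ℤ.+ ∑ₗ (catalanWords (1 ℕ.+ n)) N
    ≡⟨ cong (ℤ._+ ∑ₗ (catalanWords (1 ℕ.+ n)) N) (∑ₗ-neg (catalanWords (1 ℕ.+ n)) M) ⟩
  ℤ.- ∑ₗ (catalanWords (1 ℕ.+ n)) M ℤ.+ ∑ₗ (catalanWords (1 ℕ.+ n)) N
    ≡⟨ cong₂ (λ x y → ℤ.- x ℤ.+ y)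
             (numerator-⊙-g-coeff (Mexp k) (suc k) i (suc n) m)
             (numerator-⊙-g-coeff (Nexp k) 0 i (suc n) m) ⟨
  ℤ.- (Mnum k ⊙ g (suc k)) i (2 ℕ.+ n) m ℤ.+ (Nnum k ⊙ g 0) i (2 ℕ.+ n) m
    ≡⟨ +-𝐁-difference-≢1 k i m _ (λ ()) ⟨
  (ℤ.- (Mnum k ⊙ g (suc k)) i (2 ℕ.+ n) m ℤ.+ (Nnum k ⊙ g 0) i (2 ℕ.+ n) m) ℤ.+
    𝐁-difference k i (2 ℕ.+ n) m ∎
  where
  open ≡.≡-Reasoning
  M N : List ℕ → ℤ
  M w = ∑₄ (Mterm (suc n) k m (bck w) (lastLetter w) i)
  N w = ∑₄ (Nterm (suc n) k m (bck w) (lastLetter w) i)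

g-multiplied-equation : ∀ k i →
  denominator k *ˢ g k i ≈ˢ
  (-ˢ (Mnum k ⊙ g (suc k)) i +ˢ (Nnum k ⊙ g 0) i) +ˢ denominator k *ˢ 𝐁 (Q ^ˢ k) i
g-multiplied-equation k i n m = begin
  (denominator k *ˢ g k i) n m
    ≡⟨ denominator-*ˢ k (g k i) n m ⟩
  g k i n m ℤ.- (monomial 0 (suc k) *ˢ g k i) n m
    ≡⟨ g-difference-coeff k i n m ⟩
  (ℤ.- (Mnum k ⊙ g (suc k)) i n m ℤ.+ (Nnum k ⊙ g 0) i n m) ℤ.+ 𝐁-difference k i n m
    ≡⟨ cong (λ b → (ℤ.- (Mnum k ⊙ g (suc k)) i n m ℤ.+ (Nnum k ⊙ g 0) i n m) ℤ.+ b)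
            (trans (denominator-*ˢ k (𝐁 (Q ^ˢ k) i) n m) (𝐁-difference-coeff k i n m)) ⟨
  ((-ˢ (Mnum k ⊙ g (suc k)) i +ˢ (Nnum k ⊙ g 0) i) +ˢ denominator k *ˢ 𝐁 (Q ^ˢ k) i) n m ∎
  where open ≡.≡-Reasoning

module _ (k : ℕ) where

  private
    zero-entry : ∀ {f} → f ≈ˢ 0ˢ → 0ˢ ≈ˢ -ˢ (f *ˢ inverse k)
    zero-entry f≈0 =
      ≈ˢ-sym (≈ˢ-trans (-‿cong (≈ˢ-trans (*-congʳ {inverse k} f≈0) (zeroˡ (inverse k)))) -0#≈0#)

    unit-entry : ∀ {f e} → f ≈ˢ monomial 1 e →
      -ˢ (f *ˢ inverse k) ≈ˢ -ˢ (((+ 1) ∙ˢ monomial 1 e) *ˢ inverse k)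
    unit-entry f≈ = -‿cong (*-congʳ {inverse k} (λ n m → trans (f≈ n m) (sym (ℤ.*-identityˡ _))))

  𝐌-numerator : ∀ i j → 𝐌 (Q ^ˢ k) i j ≈ˢ -ˢ (Mnum k i j *ˢ inverse k)
  𝐌-numerator 0F 0F = zero-entry (λ _ _ → refl)
  𝐌-numerator 0F 1F = zero-entry (λ _ _ → refl)
  𝐌-numerator 0F 2F = unit-entry (XQ^kQ≈ k)
  𝐌-numerator 0F 3F = unit-entry (XQ^kQ≈ k)
  𝐌-numerator 1F 0F = zero-entry (λ _ _ → refl)
  𝐌-numerator 1F 1F = zero-entry (λ _ _ → refl)
  𝐌-numerator 1F 2F = unit-entry (XQ^k²Q≈ k)
  𝐌-numerator 1F 3F = unit-entry (XQ^k≈ k)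
  𝐌-numerator 2F 0F = unit-entry (XQ^kQ≈ k)
  𝐌-numerator 2F 1F = unit-entry (XQ^kQ≈ k)
  𝐌-numerator 2F 2F = zero-entry (λ _ _ → refl)
  𝐌-numerator 2F 3F = zero-entry (λ _ _ → refl)
  𝐌-numerator 3F 0F = unit-entry (XQ^k²Q²≈ k)
  𝐌-numerator 3F 1F = unit-entry (XQ^kQ≈ k)
  𝐌-numerator 3F 2F = zero-entry (λ _ _ → refl)
  𝐌-numerator 3F 3F = zero-entry (λ _ _ → refl)

  𝐍-numerator : ∀ i j → 𝐍 (Q ^ˢ k) i j ≈ˢ -ˢ (Nnum k i j *ˢ inverse k)
  𝐍-numerator 0F 0F = zero-entry (λ _ _ → refl)
  𝐍-numerator 0F 1F = zero-entry (λ _ _ → refl)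
  𝐍-numerator 0F 2F = unit-entry (XQ^kQ≈ k)
  𝐍-numerator 0F 3F = unit-entry (XQ^kQ≈ k)
  𝐍-numerator 1F 0F = zero-entry (λ _ _ → refl)
  𝐍-numerator 1F 1F = zero-entry (λ _ _ → refl)
  𝐍-numerator 1F 2F = unit-entry (XQ^k≈ k)
  𝐍-numerator 1F 3F = unit-entry (XQ^k≈ k)
  𝐍-numerator 2F 0F = unit-entry (XQ^kQ≈ k)
  𝐍-numerator 2F 1F = unit-entry (XQ^kQ≈ k)
  𝐍-numerator 2F 2F = zero-entry (λ _ _ → refl)
  𝐍-numerator 2F 3F = zero-entry (λ _ _ → refl)
  𝐍-numerator 3F 0F = unit-entry (XQ^kQ≈ k)
  𝐍-numerator 3F 1F = unit-entry (XQ^kQ≈ k)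
  𝐍-numerator 3F 2F = zero-entry (λ _ _ → refl)
  𝐍-numerator 3F 3F = zero-entry (λ _ _ → refl)

g-functional-equation : ∀ k → g k ≈ⱽ 𝐌 (Q ^ˢ k) ⊙ g (suc k) +ⱽ -ⱽ (𝐍 (Q ^ˢ k) ⊙ g 0) +ⱽ 𝐁 (Q ^ˢ k)
g-functional-equation k i = begin
  g k i
    ≈⟨ cancel (g k i) ⟨
  inv *ˢ (denominator k *ˢ g k i)
    ≈⟨ *-congˡ {inv} (g-multiplied-equation k i) ⟩
  inv *ˢ ((-ˢ (Mnum k ⊙ g (suc k)) i +ˢ (Nnum k ⊙ g 0) i) +ˢ denominator k *ˢ 𝐁 u i)
    ≈⟨ ≈ˢ-trans (distribˡ inv (-ˢ (Mnum k ⊙ g (suc k)) i +ˢ (Nnum k ⊙ g 0) i) (denominator k *ˢ 𝐁 u i))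
                (+-congʳ (distribˡ inv (-ˢ (Mnum k ⊙ g (suc k)) i) ((Nnum k ⊙ g 0) i))) ⟩
  (inv *ˢ -ˢ (Mnum k ⊙ g (suc k)) i +ˢ inv *ˢ (Nnum k ⊙ g 0) i) +ˢ inv *ˢ (denominator k *ˢ 𝐁 u i)
    ≈⟨ +-cong (+-cong M-part (*ˢ-⊙-negated {inv} {𝐍 u} {Nnum k} (g 0) i (𝐍-numerator k i)))
              (cancel (𝐁 u i)) ⟩
  ((𝐌 u ⊙ g (suc k)) i +ˢ -ˢ (𝐍 u ⊙ g 0) i) +ˢ 𝐁 u i ∎
  where
  open ≈ˢ-Reasoning
  u inv : Series
  u = Q ^ˢ k
  inv = inverse k
  cancel : ∀ f → inv *ˢ (denominator k *ˢ f) ≈ˢ f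
  cancel f = ≈ˢ-trans (≈ˢ-sym (*-assoc inv (denominator k) f))
               (≈ˢ-trans (*-congʳ {f} (inverse-denominator k)) (*-identityˡ f))
  M-part : inv *ˢ -ˢ (Mnum k ⊙ g (suc k)) i ≈ˢ (𝐌 u ⊙ g (suc k)) i
  M-part = ≈ˢ-trans (≈ˢ-sym (-‿distribʳ-* inv ((Mnum k ⊙ g (suc k)) i)))
    (≈ˢ-trans (-‿cong (*ˢ-⊙-negated {inv} {𝐌 u} {Mnum k} (g (suc k)) i (𝐌-numerator k i)))
              (-‿involutive _))

-- Unrolling the functional equation

x^1∣-over-numerator : ∀ e k i j → x^ 1 ∣ -ˢ (numerator e i j *ˢ inverse k)
x^1∣-over-numerator e k i j =
  x^∣-neg (x^∣-* (x^∣-∙ˢ (support i j) (x^∣-monomial 1 (e i j))) (x^0∣ (inverse k)))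

x^1∣ᴹ𝐌 : ∀ k → x^ 1 ∣ᴹ 𝐌 (Q ^ˢ k)
x^1∣ᴹ𝐌 k i j = x^∣-resp-≈ˢ (≈ˢ-sym (𝐌-numerator k i j)) (x^1∣-over-numerator (Mexp k) k i j)

x^1∣ᴹ𝐍 : ∀ k → x^ 1 ∣ᴹ 𝐍 (Q ^ˢ k)
x^1∣ᴹ𝐍 k i j = x^∣-resp-≈ˢ (≈ˢ-sym (𝐍-numerator k i j)) (x^1∣-over-numerator (Nexp k) k i j)

x^∣ᴹ𝐏 : ∀ k → x^ k ∣ᴹ 𝐏 k
x^∣ᴹ𝐏 zero    i j = x^0∣ _
x^∣ᴹ𝐏 (suc k) = x^∣ᴹ-·-suc (x^∣ᴹ𝐏 k) (x^1∣ᴹ𝐌 k)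

x^∣ᴹ𝐏𝐍 : ∀ k → x^ suc k ∣ᴹ 𝐏 k · 𝐍 (Q ^ˢ k)
x^∣ᴹ𝐏𝐍 k = x^∣ᴹ-·-suc (x^∣ᴹ𝐏 k) (x^1∣ᴹ𝐍 k)

x^1∣ᴹ𝐒 : x^ 1 ∣ᴹ 𝐒
x^1∣ᴹ𝐒 i j = x^∣-Σ∞ (λ k → x^∣-weaken (s≤s z≤n) (x^∣ᴹ𝐏𝐍 k i j))

∑ⱽ< : ℕ → (ℕ → Vec4) → Vec4
∑ⱽ< zero    t i = 0ˢ
∑ⱽ< (suc K) t = ∑ⱽ< K t +ⱽ t K

∑ⱽ<-coeff : ∀ N t i n m → ∑ⱽ< (suc N) t i n m ≡ ∑ˢ N (λ k → t k i) n m
∑ⱽ<-coeff zero    t i n m = ℤ.+-identityˡ _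
∑ⱽ<-coeff (suc N) t i n m = cong (ℤ._+ t (suc N) i n m) (∑ⱽ<-coeff N t i n m)

unrolled : ℕ → Vec4
unrolled k = 𝐏 k ⊙ 𝐁 (Q ^ˢ k) +ⱽ -ⱽ ((𝐏 k · 𝐍 (Q ^ˢ k)) ⊙ g 0)

g-unrolled : ∀ K → g 0 ≈ⱽ ∑ⱽ< K unrolled +ⱽ 𝐏 K ⊙ g K
g-unrolled zero    i = ≈ˢ-sym (≈ˢ-trans (+-identityˡ _) (I₄-⊙ (g 0) i))
g-unrolled (suc K) i n m =
  trans (g-unrolled K i n m) (trans (cong (λ z → ∑ⱽ< K unrolled i n m ℤ.+ z) (unroll n m))
        (rearrange (∑ⱽ< K unrolled i n m) ((𝐏 (suc K) ⊙ g (suc K)) i n m) (((𝐏 K · 𝐍 u) ⊙ g 0) i n m)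
                   ((𝐏 K ⊙ 𝐁 u) i n m)))
  where
  u : Series
  u = Q ^ˢ K
  rearrange : ∀ x a b c → x ℤ.+ ((a ℤ.- b) ℤ.+ c) ≡ (x ℤ.+ (c ℤ.- b)) ℤ.+ a
  rearrange = ℤ-Solver.solve-∀
  unroll : (𝐏 K ⊙ g K) i ≈ˢ ((𝐏 (suc K) ⊙ g (suc K)) i +ˢ -ˢ ((𝐏 K · 𝐍 u) ⊙ g 0) i) +ˢ (𝐏 K ⊙ 𝐁 u) i
  unroll = begin
    (𝐏 K ⊙ g K) i
      ≈⟨ ⊙-congʳ (𝐏 K) (g-functional-equation K) i ⟩
    (𝐏 K ⊙ (𝐌 u ⊙ g (suc K) +ⱽ -ⱽ (𝐍 u ⊙ g 0) +ⱽ 𝐁 u)) i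
      ≈⟨ ⊙-distrib-+ⱽ (𝐏 K) (𝐌 u ⊙ g (suc K) +ⱽ -ⱽ (𝐍 u ⊙ g 0)) (𝐁 u) i ⟩
    (𝐏 K ⊙ (𝐌 u ⊙ g (suc K) +ⱽ -ⱽ (𝐍 u ⊙ g 0))) i +ˢ (𝐏 K ⊙ 𝐁 u) i
      ≈⟨ +-congʳ (⊙-distrib-+ⱽ (𝐏 K) (𝐌 u ⊙ g (suc K)) (-ⱽ (𝐍 u ⊙ g 0)) i) ⟩
    ((𝐏 K ⊙ (𝐌 u ⊙ g (suc K))) i +ˢ (𝐏 K ⊙ -ⱽ (𝐍 u ⊙ g 0)) i) +ˢ (𝐏 K ⊙ 𝐁 u) i
      ≈⟨ +-congʳ (+-cong (≈ˢ-sym (·-⊙ (𝐏 K) (𝐌 u) (g (suc K)) i))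
                         (≈ˢ-trans (⊙-neg (𝐏 K) (𝐍 u ⊙ g 0) i)
                                   (-‿cong (≈ˢ-sym (·-⊙ (𝐏 K) (𝐍 u) (g 0) i))))) ⟩
    ((𝐏 (suc K) ⊙ g (suc K)) i +ˢ -ˢ ((𝐏 K · 𝐍 u) ⊙ g 0) i) +ˢ (𝐏 K ⊙ 𝐁 u) i ∎
    where open ≈ˢ-Reasoning

g-unrolled-coeff : ∀ i n m → g 0 i n m ≡
  ∑ˢ n (λ k → (𝐏 k ⊙ 𝐁 (Q ^ˢ k)) i) n m ℤ.- ∑ˢ n (λ k → ((𝐏 k · 𝐍 (Q ^ˢ k)) ⊙ g 0) i) n m
g-unrolled-coeff i n m = begin
  g 0 i n m
    ≡⟨ g-unrolled (suc n) i n m ⟩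
  ∑ⱽ< (suc n) unrolled i n m ℤ.+ (𝐏 (suc n) ⊙ g (suc n)) i n m
    ≡⟨ cong₂ ℤ._+_ (∑ⱽ<-coeff n unrolled i n m)
         (x^∣ⱽ-⊙ (x^∣ᴹ𝐏 (suc n)) (λ j → x^0∣ (g (suc n) j)) i n m (ℕ.m≤m+n (suc n) 0)) ⟩
  ∑ˢ n (λ k → unrolled k i) n m ℤ.+ + 0
    ≡⟨ ℤ.+-identityʳ _ ⟩
  ∑ˢ n (λ k → unrolled k i) n m
    ≡⟨ sumTo-distrib-+ n _ _ ⟩
  ∑ˢ n (λ k → (𝐏 k ⊙ 𝐁 (Q ^ˢ k)) i) n m ℤ.+ sumTo n (λ k → ℤ.- ((𝐏 k · 𝐍 (Q ^ˢ k)) ⊙ g 0) i n m)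
    ≡⟨ cong (λ z → ∑ˢ n (λ k → (𝐏 k ⊙ 𝐁 (Q ^ˢ k)) i) n m ℤ.+ z) (sumTo-neg n _) ⟩
  ∑ˢ n (λ k → (𝐏 k ⊙ 𝐁 (Q ^ˢ k)) i) n m ℤ.- ∑ˢ n (λ k → ((𝐏 k · 𝐍 (Q ^ˢ k)) ⊙ g 0) i) n m ∎
  where open ≡.≡-Reasoning

g-fixed-point : Σ∞ⱽ (λ k → 𝐏 k ⊙ 𝐁 (Q ^ˢ k)) ≈ⱽ g 0 +ⱽ 𝐒 ⊙ g 0
g-fixed-point i n m = begin
  Σ∞ⱽ (λ k → 𝐏 k ⊙ 𝐁 (Q ^ˢ k)) i n m
    ≡⟨ Σ∞-truncate (λ k → x^∣-weaken (ℕ.m≤m+n k 0) (x^∣ⱽ-⊙ (x^∣ᴹ𝐏 k) (λ j → x^0∣ (𝐁 (Q ^ˢ k) j)) i))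
                   n m ℕ.≤-refl ⟩
  b
    ≡⟨ cancel b s ⟨
  (b ℤ.- s) ℤ.+ s
    ≡⟨ cong₂ ℤ._+_ (g-unrolled-coeff i n m) (Σ∞ᴹ-⊙-coeff x^k∣ᴹ𝐏𝐍 (g 0) i n m ℕ.≤-refl) ⟨
  g 0 i n m ℤ.+ (𝐒 ⊙ g 0) i n m ∎
  where
  open ≡.≡-Reasoning
  b s : ℤ
  b = ∑ˢ n (λ k → (𝐏 k ⊙ 𝐁 (Q ^ˢ k)) i) n m
  s = ∑ˢ n (λ k → ((𝐏 k · 𝐍 (Q ^ˢ k)) ⊙ g 0) i) n m
  cancel : ∀ b s → (b ℤ.- s) ℤ.+ s ≡ b
  cancel = ℤ-Solver.solve-∀
  x^k∣ᴹ𝐏𝐍 : ∀ k → x^ k ∣ᴹ 𝐏 k · 𝐍 (Q ^ˢ k)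
  x^k∣ᴹ𝐏𝐍 k i j = x^∣-weaken (ℕ.n≤1+n k) (x^∣ᴹ𝐏𝐍 k i j)

theorem2p4 : (i : Fin 4) (n m : ℕ) →
    𝐆₁ i n m ≡ ((Σ∞ᴹ (λ k → negM 𝐒 ^ᴹ k)) ⊙ Σ∞ⱽ (λ k → 𝐏 k ⊙ 𝐁 (Q ^ˢ k))) i n m
theorem2p4 i n m = sym (neumann-series {G = g 0} x^1∣ᴹ𝐒 g-fixed-point i n m)
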